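{- Let $k\ge2$, let $\mathcal H$ be a $k$-graph on $[n]$, $d\ge1$, and $d_1,\dots,d_n\ge0$ with $\sum d_i=d$. Let $\hat f$ be a monomial differential operator (a product of operators $\partial/\partial A_{ij}$, scalar coefficient discarded) occurring in the expansion of $\prod_{i=1}^n\hat f_i^{d_i}$, and let $D=D_{\hat f}$ be its associated digraph. Then $\hat f\,\mathrm{tr}(A^{d(k-1)})\ne0$ if and only if $D$ is Eulerian, and in that case \[ \hat f\,\mathrm{tr}(A^{d(k-1)})=|E(D)|\,|\mathfrak E(D)|. \]
   Context: The normalized adjacency hypermatrix of $\mathcal H$ has entries $a_{i_1\dots i_k}=\frac1{(k-1)!}$ if $\{i_1,\dots,i_k\}\in E(\mathcal H)$, else $0$. Let $f_i(x)=\sum_{i_2,\dots,i_k}a_{ii_2\dots i_k}x_{i_2}\cdots x_{i_k}$, let $A=(A_{ij})$ be an $n\times n$ matrix of independent variables, and $\hat f_i=f_i(\partial/\partial A_{i1},\dots,\partial/\partial A_{in})$. The associated digraph $D_{\hat f}$ of a monomial operator $\hat f$ is the directed multigraph with $m$ distinguishable arcs from $i$ to $j$ whenever $(\partial/\partial A_{ij})^m$ is the exact power of $\partial/\partial A_{ij}$ in $\hat f$, with isolated vertices removed. A digraph is Eulerian if it is weakly connected and in-degree equals out-degree at every vertex. $\mathfrak E(D)$ is the set of Euler circuits of $D$: closed walks using every (distinguishable) arc exactly once, considered up to cyclic rotation. -}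

module Defs where

open import Data.Nat using (ℕ; zero; suc; _∸_)
open import Data.Bool using (Bool; true; false; if_then_else_)
open import Data.Fin using (Fin; _≟_)
open import Data.Fin.Subset using (Subset; ⁅_⁆; _∪_; ∣_∣) renaming (⊥ to ∅)
open import Data.List using (List; []; _∷_; _++_; map; concat; concatMap; length; lookup; allFin; filter)
open import Data.List.Membership.Propositional using (_∈_)
open import Data.List.Relation.Unary.All using (All)
open import Data.List.Relation.Unary.Any using (Any)
open import Data.List.Relation.Binary.Permutation.Propositional using (_↭_)
open import Data.Vec using (Vec; toList)
open import Data.Product using (Σ; _×_; _,_; proj₁; proj₂; ∃)
open import Data.Unit using (⊤)
open import Relation.Binary.PropositionalEquality using (_≡_)
open import Relation.Nullary.Decidable using (⌊_⌋)
open import Function.Bundles using (_⇔_)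

record KGraph (n k : ℕ) : Set where
  field
    edges   : List (Subset n)
    uniform : All (λ e → ∣ e ∣ ≡ k) edges
open KGraph public

toSubset : ∀ {n} → List (Fin n) → Subset n
toSubset []       = ∅
toSubset (j ∷ js) = ⁅ j ⁆ ∪ toSubset js

-- a_{i i₂ … i_k} ≠ 0  iff  {i,i₂,…,i_k} ∈ E(H)
NonzeroEntry : ∀ {n k} → KGraph n k → Fin n → Vec (Fin n) (k ∸ 1) → Set
NonzeroEntry H i t = toSubset (i ∷ toList t) ∈ edges H

-- Variables A_{ij}, monomials (commutative products of variables, kept as
-- lists), polynomials with ℕ coefficients as formal sums of monomials
-- (each list entry is a monomial with coefficient 1).

Var : ℕ → Set
Var n = Fin n × Fin n

Monomial : ℕ → Set
Monomial n = List (Var n)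

Poly : ℕ → Set
Poly n = List (Monomial n)

_≟V_ : ∀ {n} → Var n → Var n → Bool
(a , b) ≟V (c , e) = ⌊ a ≟ c ⌋ Data.Bool.∧ ⌊ b ≟ e ⌋
  where import Data.Bool

-- (A^N)_{ij} = sum over walks i → j of length N of ∏ A_{edge}
walks : ∀ {n} → ℕ → Fin n → Fin n → Poly n
walks zero    i j = if ⌊ i ≟ j ⌋ then ([] ∷ []) else []
walks {n} (suc N) i j = concatMap (λ l → map ((i , l) ∷_) (walks N l j)) (allFin n)

trPow : (n N : ℕ) → Poly n
trPow n N = concatMap (λ i → walks N i i) (allFin n)

derivMono : ∀ {n} → Var n → Monomial n → Poly n
derivMono v []       = []
derivMono v (x ∷ xs) = (if x ≟V v then (xs ∷ []) else []) ++ map (x ∷_) (derivMono v xs)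

deriv : ∀ {n} → Var n → Poly n → Poly n
deriv v = concatMap (derivMono v)

-- a monomial differential operator ∏ ∂/∂A_{ij} (list of the variables,
-- with multiplicity) applied to a polynomial
applyOp : ∀ {n} → List (Var n) → Poly n → Poly n
applyOp []       p = p
applyOp (v ∷ vs) p = deriv v (applyOp vs p)

-- polynomial (ℕ coefficients, no cancellation) is the zero polynomial
IsZeroPoly : ∀ {n} → Poly n → Set
IsZeroPoly p = p ≡ []

IsConst : ∀ {n} → Poly n → ℕ → Set
IsConst p c = All (_≡ []) p × length p ≡ c

-- Monomials of ∏ f̂_i^{d_i}: for each i a choice of d_i index tuples
-- (i₂,…,i_k) with a_{i i₂…i_k} ≠ 0; the monomial is
-- ∏_i ∏_{tuples} ∂/∂A_{i i₂}⋯∂/∂A_{i i_k}.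

Choice : ∀ {n k} → KGraph n k → (Fin n → ℕ) → Set
Choice {n} {k} H ds = (i : Fin n) → Vec (Σ (Vec (Fin n) (k ∸ 1)) (NonzeroEntry H i)) (ds i)

operatorOf : ∀ {n k} (H : KGraph n k) (ds : Fin n → ℕ) → Choice H ds → List (Var n)
operatorOf {n} H ds ch =
  concatMap (λ i → concatMap (λ t → map (λ j → (i , j)) (toList (proj₁ t))) (toList (ch i)))
            (allFin n)

-- The associated digraph D: its arcs are the entries of the operator list
-- (distinguishable, multiplicity = exponent); vertices = those incident
-- to some arc (isolated vertices removed).

module _ {n : ℕ} (D : List (Var n)) where

  IsVertex : Fin n → Set
  IsVertex v = Any (λ a → proj₁ a ≡ v) D Data.Sum.⊎ Any (λ a → proj₂ a ≡ v) D
    where import Data.Sum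

  outdeg indeg : Fin n → ℕ
  outdeg v = length (filter (λ a → proj₁ a ≟ v) D)
  indeg  v = length (filter (λ a → proj₂ a ≟ v) D)

  data UReach : Fin n → Fin n → Set where
    here  : ∀ {u} → UReach u u
    fwd   : ∀ {u w v} → (u , w) ∈ D → UReach w v → UReach u v
    bwd   : ∀ {u w v} → (w , u) ∈ D → UReach w v → UReach u v

  WeaklyConnected : Set
  WeaklyConnected = ∀ u v → IsVertex u → IsVertex v → UReach u v

  Eulerian : Set
  Eulerian = WeaklyConnected × (∀ v → indeg v ≡ outdeg v)

Chain : ∀ {n} → List (Var n) → Set
Chain []            = ⊤
Chain (x ∷ [])      = ⊤
Chain (x ∷ y ∷ r)   = proj₂ x ≡ proj₁ y × Chain (y ∷ r)

CyclicChain : ∀ {n} → List (Var n) → Set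
CyclicChain []       = ⊤
CyclicChain (a ∷ as) = Chain (a ∷ as ++ a ∷ [])

rot : ∀ {A : Set} → List A → List A
rot []       = []
rot (x ∷ xs) = xs ++ x ∷ []

rotN : ∀ {A : Set} → ℕ → List A → List A
rotN zero    xs = xs
rotN (suc r) xs = rot (rotN r xs)

-- Euler circuits as sequences of (distinguishable) arc indices: each arc
-- exactly once, consecutive arcs composable, closed.
CircuitSeq : ∀ {n} → List (Var n) → Set
CircuitSeq D = Σ (List (Fin (length D))) λ σ →
  (σ ↭ allFin (length D)) × CyclicChain (map (lookup D) σ)

RotEq : ∀ {A : Set} → List A → List A → Set
RotEq σ τ = ∃ λ r → rotN r σ ≡ τ

-- |𝔈(D)| = c : the set of circuit sequences modulo cyclic rotation is in
-- bijection with Fin c.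
EulerCount : ∀ {n} → List (Var n) → ℕ → Set
EulerCount D c = Σ (CircuitSeq D → Fin c) λ q →
  (∀ j → ∃ λ x → q x ≡ j) ×
  (∀ x y → (q x ≡ q y) ⇔ RotEq (proj₁ x) (proj₁ y))

module Submission where

open import Defs
open import Data.Bool using (Bool; true; false; if_then_else_; _∧_)
open import Data.Bool.Properties using (∧-assoc; ∧-comm; ∧-identityʳ)
open import Data.Empty using (⊥-elim)
open import Data.Fin using (Fin; zero; suc)
import Data.Fin as Fin
open import Data.Fin.Properties using (any?)
open import Data.List using (List; []; _∷_; _++_; [_]; map; concatMap; filter; length; lookup; allFin)
open import Data.List.Membership.Propositional using (_∈_; _∉_; find)
open import Data.List.Membership.Propositional.Properties
  using (∈-concatMap⁻; ∈-concatMap⁺; ∈-allFin; ∈-lookup; ∈-∃++; ∈-++⁺ʳ; ∈-map⁺; ∈-map⁻)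
open import Data.List.Properties
  using (map-cong; map-∘; ++-assoc; ++-identityʳ; ++-conicalˡ; ∷-injectiveˡ; ∷-injectiveʳ; length-++; length-map;
         concatMap-cong; concatMap-pure; concatMap-map; concatMap-++; map-concatMap; map-tabulate; tabulate-lookup;
         length-tabulate)
open import Data.List.Relation.Binary.Permutation.Propositional
  using (_↭_; prep; swap; ↭-refl; ↭-trans; ↭-sym; ↭-reflexive; ↭⇒↭ₛ; module PermutationReasoning)
import Data.List.Relation.Binary.Permutation.Propositional as Perm
open import Data.List.Relation.Binary.Permutation.Propositional.Properties
  using (++⁺; ++⁺ˡ; shift; shifts; ↭-length; map⁺; ∈-resp-↭; ∷↭∷ʳ; ++-comm)
import Data.List.Relation.Binary.Permutation.Setoid.Properties as PermSetoid
open import Data.List.Relation.Unary.All using (All; []; _∷_)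
import Data.List.Relation.Unary.All as All
import Data.List.Relation.Unary.All.Properties as All
open import Data.List.Relation.Unary.AllPairs using ([]; _∷_)
open import Data.List.Relation.Unary.Any using (Any; here; there)
import Data.List.Relation.Unary.Any as Any
open import Data.List.Relation.Unary.Any.Properties using (lookup-index)
open import Data.List.Relation.Unary.Unique.Propositional using (Unique)
import Data.List.Relation.Unary.Unique.Propositional.Properties as Unique
open import Data.Nat using (ℕ; zero; suc; _+_; _*_; _∸_; _≤_; _<_; _≡ᵇ_; z≤n; s≤s)
open import Data.Nat.ListAction using (sum; product)
open import Data.Nat.ListAction.Properties using (sum-↭)
open import Data.Nat.Properties
  using (+-comm; +-assoc; +-suc; +-identityʳ; *-comm; *-identityʳ; *-zeroʳ; *-distribʳ-+; +-cancelˡ-≡; +-cancelʳ-≡;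
         suc-injective; ≤-reflexive; ≤-trans; m≤n+m; m≤m+n; +-monoʳ-≤; +-monoʳ-<; 1+n≰n; <⇒≱; m<m+n; n<1+n;
         +-commutativeSemigroup; module ≤-Reasoning)
open import Algebra.Properties.CommutativeSemigroup +-commutativeSemigroup using (x∙yz≈y∙xz)
open import Data.Nat.Solver using (module +-*-Solver)
open +-*-Solver using (solve; _:+_; _:=_)
open import Data.Product using (Σ; ∃; _×_; _,_; proj₁; proj₂; map₁)
import Data.Product as Product
open import Data.Sum using (_⊎_; inj₁; inj₂)
open import Data.Unit using (tt)
open import Data.Vec using (toList)
open import Data.Vec.Properties using (length-toList)
open import Function using (_∘_)
open import Function.Bundles using (_⇔_; mk⇔)
open import Relation.Binary.Definitions using (DecidableEquality)
open import Relation.Binary.PropositionalEquality hiding ([_])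
open import Relation.Binary.PropositionalEquality.Properties using (setoid)
open import Relation.Nullary using (¬_; Dec; yes; no; ¬?; _×-dec_)
open import Relation.Nullary.Decidable using (⌊_⌋; decidable-stable)

-- Relabel the N arcs of D by distinct indices and substitute A_ij ↦ Σ_{arcs b : i → j} x_b.
-- By the chain rule this commutes with differentiation, so f̂ tr(A^N) has as many terms as
-- ∂_{x_1} ⋯ ∂_{x_N} applied to the sum of x_{b_1} ⋯ x_{b_N} over closed arc sequences b.
-- Such a monomial contributes a single constant term exactly when b uses every arc once,
-- i.e. when b is an Euler circuit with a chosen starting arc. Rotations act on these with
-- orbits of size N, each containing exactly one circuit starting with arc 0, which gives
-- N |𝔈(D)| terms. An Euler circuit exists iff D is Eulerian: a closed walk balances
-- degrees and connects its vertices, and conversely Hierholzer's splicing of closed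
-- walks builds a circuit.

private variable A B C : Set

-- A Boolean filter written with `if`, so that it unfolds under `with p x`
-- (the library's filterᵇ goes through T? and does not).
filterᵇ : (A → Bool) → List A → List A
filterᵇ p [] = []
filterᵇ p (x ∷ xs) = if p x then x ∷ filterᵇ p xs else filterᵇ p xs

filterᵇ-++ : (p : A → Bool) (xs ys : List A) → filterᵇ p (xs ++ ys) ≡ filterᵇ p xs ++ filterᵇ p ys
filterᵇ-++ p [] ys = refl
filterᵇ-++ p (x ∷ xs) ys with p x
... | true = cong (x ∷_) (filterᵇ-++ p xs ys)
... | false = filterᵇ-++ p xs ys

length-filterᵇ-++ : (p : A → Bool) (xs ys : List A) →
                    length (filterᵇ p (xs ++ ys)) ≡ length (filterᵇ p xs) + length (filterᵇ p ys)
length-filterᵇ-++ p xs ys = trans (cong length (filterᵇ-++ p xs ys)) (length-++ (filterᵇ p xs))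

length-filterᵇ-∷ : (p : A → Bool) (x : A) (xs : List A) →
                   length (filterᵇ p (x ∷ xs)) ≡ (if p x then 1 else 0) + length (filterᵇ p xs)
length-filterᵇ-∷ p x xs with p x
... | true = refl
... | false = refl

filterᵇ-concatMap : (p : B → Bool) (f : A → List B) (xs : List A) →
                    filterᵇ p (concatMap f xs) ≡ concatMap (filterᵇ p ∘ f) xs
filterᵇ-concatMap p f [] = refl
filterᵇ-concatMap p f (x ∷ xs) = trans (filterᵇ-++ p (f x) _) (cong (filterᵇ p (f x) ++_) (filterᵇ-concatMap p f xs))

filterᵇ-map : (p : B → Bool) (g : A → B) (xs : List A) → filterᵇ p (map g xs) ≡ map g (filterᵇ (p ∘ g) xs)
filterᵇ-map p g [] = refl
filterᵇ-map p g (x ∷ xs) with p (g x)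
... | true = cong (g x ∷_) (filterᵇ-map p g xs)
... | false = filterᵇ-map p g xs

filterᵇ-cong : {p q : A → Bool} → (∀ x → p x ≡ q x) → (xs : List A) → filterᵇ p xs ≡ filterᵇ q xs
filterᵇ-cong e [] = refl
filterᵇ-cong {q = q} e (x ∷ xs) rewrite e x with q x
... | true = cong (x ∷_) (filterᵇ-cong e xs)
... | false = filterᵇ-cong e xs

filterᵇ-false : (xs : List A) → filterᵇ (λ _ → false) xs ≡ []
filterᵇ-false [] = refl
filterᵇ-false (x ∷ xs) = filterᵇ-false xs

filterᵇ-dec : {P : A → Set} (P? : ∀ x → Dec (P x)) (xs : List A) →
              filter P? xs ≡ filterᵇ (λ x → ⌊ P? x ⌋) xs
filterᵇ-dec P? [] = refl
filterᵇ-dec P? (x ∷ xs) with P? x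
... | yes _ = cong (x ∷_) (filterᵇ-dec P? xs)
... | no _ = filterᵇ-dec P? xs

concatMap-filterᵇ : (f : A → List B) (p : A → Bool) (xs : List A) →
                    concatMap f (filterᵇ p xs) ≡ concatMap (λ x → if p x then f x else []) xs
concatMap-filterᵇ f p [] = refl
concatMap-filterᵇ f p (x ∷ xs) with p x
... | true = cong (f x ++_) (concatMap-filterᵇ f p xs)
... | false = concatMap-filterᵇ f p xs

filterᵇ-↭ : (p : A → Bool) {xs ys : List A} → xs ↭ ys → filterᵇ p xs ↭ filterᵇ p ys
filterᵇ-↭ p Perm.refl = ↭-refl
filterᵇ-↭ p (prep x q) with p x
... | true = prep x (filterᵇ-↭ p q)
... | false = filterᵇ-↭ p q
filterᵇ-↭ p (swap x y q) with p x | p y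
... | true | true = swap x y (filterᵇ-↭ p q)
... | true | false = prep x (filterᵇ-↭ p q)
... | false | true = prep y (filterᵇ-↭ p q)
... | false | false = filterᵇ-↭ p q
filterᵇ-↭ p (Perm.trans q r) = ↭-trans (filterᵇ-↭ p q) (filterᵇ-↭ p r)

∈-filterᵇ⁻ : (p : A → Bool) {x : A} (xs : List A) → x ∈ filterᵇ p xs → (x ∈ xs) × (p x ≡ true)
∈-filterᵇ⁻ p (y ∷ xs) m with p y in eq
∈-filterᵇ⁻ p (y ∷ xs) (here refl) | true = here refl , eq
∈-filterᵇ⁻ p (y ∷ xs) (there m) | true = map₁ there (∈-filterᵇ⁻ p xs m)
... | false = map₁ there (∈-filterᵇ⁻ p xs m)

∈-filterᵇ⁺ : (p : A → Bool) {x : A} (xs : List A) → x ∈ xs → p x ≡ true → x ∈ filterᵇ p xs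
∈-filterᵇ⁺ p (y ∷ xs) (here refl) px rewrite px = here refl
∈-filterᵇ⁺ p (y ∷ xs) (there m) px with p y
... | true = there (∈-filterᵇ⁺ p xs m px)
... | false = ∈-filterᵇ⁺ p xs m px

All-filterᵇ : {P : A → Set} (p : A → Bool) {xs : List A} → All P xs → All P (filterᵇ p xs)
All-filterᵇ p [] = []
All-filterᵇ p {x ∷ xs} (h ∷ hs) with p x
... | true = h ∷ All-filterᵇ p hs
... | false = All-filterᵇ p hs

unique-filterᵇ : (p : A → Bool) {xs : List A} → Unique xs → Unique (filterᵇ p xs)
unique-filterᵇ p [] = []
unique-filterᵇ p {x ∷ xs} (x∉xs ∷ u) with p x
... | true = All-filterᵇ p x∉xs ∷ unique-filterᵇ p u
... | false = unique-filterᵇ p u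

concatMap-[] : (xs : List A) → concatMap {B = B} (λ _ → []) xs ≡ []
concatMap-[] [] = refl
concatMap-[] (x ∷ xs) = concatMap-[] xs

concatMap-concatMap : (f : B → List C) (g : A → List B) (xs : List A) →
                      concatMap f (concatMap g xs) ≡ concatMap (λ x → concatMap f (g x)) xs
concatMap-concatMap f g [] = refl
concatMap-concatMap f g (x ∷ xs) =
  trans (concatMap-++ f (g x) _) (cong (concatMap f (g x) ++_) (concatMap-concatMap f g xs))

concatMap-↭ : (f : A → List B) {xs ys : List A} → xs ↭ ys → concatMap f xs ↭ concatMap f ys
concatMap-↭ f Perm.refl = ↭-refl
concatMap-↭ f (prep x p) = ++⁺ˡ (f x) (concatMap-↭ f p)
concatMap-↭ f (swap x y p) = ↭-trans (++⁺ˡ (f x) (++⁺ˡ (f y) (concatMap-↭ f p))) (shifts (f x) (f y))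
concatMap-↭ f (Perm.trans p q) = ↭-trans (concatMap-↭ f p) (concatMap-↭ f q)

concatMap-↭-pointwise : {f g : A → List B} → (∀ x → f x ↭ g x) → (xs : List A) → concatMap f xs ↭ concatMap g xs
concatMap-↭-pointwise e [] = ↭-refl
concatMap-↭-pointwise e (x ∷ xs) = ++⁺ (e x) (concatMap-↭-pointwise e xs)

concatMap-++-↭ : (f g : A → List B) (xs : List A) →
                 concatMap (λ x → f x ++ g x) xs ↭ concatMap f xs ++ concatMap g xs
concatMap-++-↭ f g [] = ↭-refl
concatMap-++-↭ f g (x ∷ xs) =
  ↭-trans (↭-reflexive (++-assoc (f x) (g x) _))
  (↭-trans (++⁺ˡ (f x) (++⁺ˡ (g x) (concatMap-++-↭ f g xs)))
  (↭-trans (++⁺ˡ (f x) (shifts (g x) (concatMap f xs)))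
  (↭-reflexive (sym (++-assoc (f x) _ _)))))

concatMap-comm-↭ : (h : A → B → List C) (xs : List A) (ys : List B) →
  concatMap (λ x → concatMap (h x) ys) xs ↭ concatMap (λ y → concatMap (λ x → h x y) xs) ys
concatMap-comm-↭ h [] ys = ↭-reflexive (sym (concatMap-[] ys))
concatMap-comm-↭ h (x ∷ xs) ys =
  ↭-trans (++⁺ˡ (concatMap (h x) ys) (concatMap-comm-↭ h xs ys))
          (↭-sym (concatMap-++-↭ (h x) (λ y → concatMap (λ x → h x y) xs) ys))

length-concatMap-const : (f : A → List B) (k : ℕ) {xs : List A} → All (λ x → length (f x) ≡ k) xs →
                         length (concatMap f xs) ≡ length xs * k
length-concatMap-const f k [] = refl
length-concatMap-const f k {x ∷ xs} (e ∷ es) = trans (length-++ (f x)) (cong₂ _+_ e (length-concatMap-const f k es))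

length-concatMap-indicator : (f : A → List B) (p : A → Bool) {xs : List A} →
  All (λ x → length (f x) ≡ (if p x then 1 else 0)) xs → length (concatMap f xs) ≡ length (filterᵇ p xs)
length-concatMap-indicator f p [] = refl
length-concatMap-indicator f p {x ∷ xs} (e ∷ es) with p x
... | true = trans (length-++ (f x)) (cong₂ _+_ e (length-concatMap-indicator f p es))
... | false = trans (length-++ (f x)) (cong₂ _+_ e (length-concatMap-indicator f p es))

All-concatMap : {P : B → Set} {Q : A → Set} (f : A → List B) {xs : List A} →
                (∀ {x} → Q x → All P (f x)) → All Q xs → All P (concatMap f xs)
All-concatMap f h qs = All.concat⁺ (All.map⁺ (All.map h qs))

All-concatMap⁺ : {P : B → Set} (f : A → List B) (xs : List A) → (∀ x → All P (f x)) → All P (concatMap f xs)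
All-concatMap⁺ f xs h = All.concat⁺ (All.map⁺ (All.tabulate {xs = xs} (λ {x} _ → h x)))

sum-map-zero : (xs : List A) → sum (map (λ _ → 0) xs) ≡ 0
sum-map-zero [] = refl
sum-map-zero (_ ∷ xs) = sum-map-zero xs

sum-map-ones : (f : A → ℕ) {xs : List A} → All (λ x → f x ≡ 1) xs → sum (map f xs) ≡ length xs
sum-map-ones f [] = refl
sum-map-ones f (e ∷ es) = cong₂ _+_ e (sum-map-ones f es)

sum-indicator : (p : A → Bool) (xs : List A) → sum (map (λ x → if p x then 1 else 0) xs) ≡ length (filterᵇ p xs)
sum-indicator p [] = refl
sum-indicator p (x ∷ xs) with p x
... | true = cong suc (sum-indicator p xs)
... | false = sum-indicator p xs

sum-map-+ : (f g : A → ℕ) (xs : List A) → sum (map (λ x → f x + g x) xs) ≡ sum (map f xs) + sum (map g xs)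
sum-map-+ f g [] = refl
sum-map-+ f g (x ∷ xs) = begin
  f x + g x + sum (map (λ x → f x + g x) xs)          ≡⟨ cong (f x + g x +_) (sum-map-+ f g xs) ⟩
  f x + g x + (sum (map f xs) + sum (map g xs))       ≡⟨ +-assoc (f x) (g x) _ ⟩
  f x + (g x + (sum (map f xs) + sum (map g xs)))     ≡⟨ cong (f x +_) (x∙yz≈y∙xz (g x) (sum (map f xs)) _) ⟩
  f x + (sum (map f xs) + (g x + sum (map g xs)))     ≡⟨ sym (+-assoc (f x) _ _) ⟩
  f x + sum (map f xs) + (g x + sum (map g xs))       ∎
  where open ≡-Reasoning

length-concatMap : (f : A → List B) (xs : List A) → length (concatMap f xs) ≡ sum (map (length ∘ f) xs)
length-concatMap f [] = refl
length-concatMap f (x ∷ xs) = trans (length-++ (f x)) (cong (length (f x) +_) (length-concatMap f xs))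

sum-map-*ʳ : (g : A → ℕ) (c : ℕ) (xs : List A) → sum (map (λ x → g x * c) xs) ≡ sum (map g xs) * c
sum-map-*ʳ g c [] = refl
sum-map-*ʳ g c (x ∷ xs) = trans (cong (g x * c +_) (sum-map-*ʳ g c xs)) (sym (*-distribʳ-+ c (g x) _))

length-allFin : ∀ k → length (allFin k) ≡ k
length-allFin k = length-tabulate (λ x → x)

rot-↭ : (xs : List A) → rot xs ↭ xs
rot-↭ [] = ↭-refl
rot-↭ (x ∷ xs) = ↭-sym (∷↭∷ʳ x xs)

rotN-suc : (r : ℕ) (xs : List A) → rotN (suc r) xs ≡ rotN r (rot xs)
rotN-suc zero xs = refl
rotN-suc (suc r) xs = cong rot (rotN-suc r xs)

rotN-+ : (p q : ℕ) (xs : List A) → rotN p (rotN q xs) ≡ rotN (p + q) xs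
rotN-+ zero q xs = refl
rotN-+ (suc p) q xs = cong rot (rotN-+ p q xs)

rotN-++ : (xs ys : List A) → rotN (length xs) (xs ++ ys) ≡ ys ++ xs
rotN-++ [] ys = sym (++-identityʳ ys)
rotN-++ (x ∷ xs) ys = begin
  rotN (suc (length xs)) (x ∷ xs ++ ys)    ≡⟨ rotN-suc (length xs) (x ∷ xs ++ ys) ⟩
  rotN (length xs) ((xs ++ ys) ++ [ x ])    ≡⟨ cong (rotN (length xs)) (++-assoc xs ys [ x ]) ⟩
  rotN (length xs) (xs ++ ys ++ [ x ])      ≡⟨ rotN-++ xs (ys ++ [ x ]) ⟩
  (ys ++ [ x ]) ++ xs                       ≡⟨ ++-assoc ys [ x ] xs ⟩
  ys ++ x ∷ xs                              ∎
  where open ≡-Reasoning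

map-rot-filterᵇ : (p : List A → Bool) → (∀ σ → p (rot σ) ≡ p σ) → (xss : List (List A)) →
                  map rot (filterᵇ p xss) ≡ filterᵇ p (map rot xss)
map-rot-filterᵇ p p-rot xss = sym (trans (filterᵇ-map p rot xss) (cong (map rot) (filterᵇ-cong p-rot xss)))

index-∈-lookup : (xs : List A) (i : Fin (length xs)) → Any.index (∈-lookup {xs = xs} i) ≡ i
index-∈-lookup (x ∷ xs) zero = refl
index-∈-lookup (x ∷ xs) (suc i) = cong suc (index-∈-lookup xs i)

index-unique : {x : A} {xs : List A} → Unique xs → (m m′ : x ∈ xs) → Any.index m ≡ Any.index m′
index-unique _ (here refl) (here refl) = refl
index-unique (x∉xs ∷ _) (here refl) (there m′) = ⊥-elim (All.lookup x∉xs m′ refl)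
index-unique (x∉xs ∷ _) (there m) (here refl) = ⊥-elim (All.lookup x∉xs m refl)
index-unique (_ ∷ u) (there m) (there m′) = cong suc (index-unique u m m′)

unique-↭ : {xs ys : List A} → xs ↭ ys → Unique xs → Unique ys
unique-↭ p = PermSetoid.Unique-resp-↭ (setoid _) (↭⇒↭ₛ p)

unique-∷ : {a : A} {ys : List A} → a ∉ ys → Unique ys → Unique (a ∷ ys)
unique-∷ {ys = ys} a∉ u = All.tabulate (λ m a≡ → a∉ (subst (_∈ ys) (sym a≡) m)) ∷ u

unique-∷ʳ : {a : A} {ys : List A} → a ∉ ys → Unique ys → Unique (ys ++ [ a ])
unique-∷ʳ {a = a} {ys} a∉ u = unique-↭ (∷↭∷ʳ a ys) (unique-∷ a∉ u)

++-∷ʳ≢[] : (xs : List A) (a : A) → ¬ xs ++ [ a ] ≡ []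
++-∷ʳ≢[] [] a ()
++-∷ʳ≢[] (_ ∷ _) a ()

≢[]⇒length>0 : (xs : List A) → ¬ xs ≡ [] → 0 < length xs
≢[]⇒length>0 [] xs≢[] = ⊥-elim (xs≢[] refl)
≢[]⇒length>0 (_ ∷ _) _ = s≤s z≤n

∧≡true⁻ : ∀ {a b : Bool} → (a ∧ b) ≡ true → (a ≡ true) × (b ≡ true)
∧≡true⁻ {true} {true} _ = refl , refl

∧≡true⁺ : ∀ {a b : Bool} → a ≡ true → b ≡ true → (a ∧ b) ≡ true
∧≡true⁺ refl refl = refl

module Counting {A : Set} (_≟_ : DecidableEquality A) where

  _==_ : A → A → Bool
  a == b = ⌊ a ≟ b ⌋

  ==-refl : (a : A) → (a == a) ≡ true
  ==-refl a with a ≟ a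
  ... | yes _ = refl
  ... | no a≢a = ⊥-elim (a≢a refl)

  ==-sym : (a b : A) → (a == b) ≡ (b == a)
  ==-sym a b with a ≟ b | b ≟ a
  ... | yes _ | yes _ = refl
  ... | no _ | no _ = refl
  ... | yes a≡b | no b≢a = ⊥-elim (b≢a (sym a≡b))
  ... | no a≢b | yes b≡a = ⊥-elim (a≢b (sym b≡a))

  ==⇒≡ : {a b : A} → (a == b) ≡ true → a ≡ b
  ==⇒≡ {a} {b} e with a ≟ b
  ... | yes a≡b = a≡b

  ≡⇒== : {a b : A} → a ≡ b → (a == b) ≡ true
  ≡⇒== {a} refl = ==-refl a

  ≢⇒== : {a b : A} → ¬ a ≡ b → (a == b) ≡ false
  ≢⇒== {a} {b} a≢b with a ≟ b
  ... | yes a≡b = ⊥-elim (a≢b a≡b)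
  ... | no _ = refl

  count : A → List A → ℕ
  count a xs = length (filterᵇ (_== a) xs)

  count-∷ : (a y : A) (xs : List A) → count a (y ∷ xs) ≡ (if y == a then 1 else 0) + count a xs
  count-∷ a y xs = length-filterᵇ-∷ (_== a) y xs

  count-++ : (a : A) (xs ys : List A) → count a (xs ++ ys) ≡ count a xs + count a ys
  count-++ a = length-filterᵇ-++ (_== a)

  count-↭ : (a : A) {xs ys : List A} → xs ↭ ys → count a xs ≡ count a ys
  count-↭ a p = ↭-length (filterᵇ-↭ _ p)

  count≢0⇒∈ : (a : A) (xs : List A) → ¬ count a xs ≡ 0 → a ∈ xs
  count≢0⇒∈ a [] c≢0 = ⊥-elim (c≢0 refl)
  count≢0⇒∈ a (y ∷ xs) c≢0 with y ≟ a
  ... | yes refl = here refl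
  ... | no _ = there (count≢0⇒∈ a xs c≢0)

  ∈⇒count≢0 : (a : A) (xs : List A) → a ∈ xs → ¬ count a xs ≡ 0
  ∈⇒count≢0 a (y ∷ xs) (here refl) rewrite ==-refl y = λ ()
  ∈⇒count≢0 a (y ∷ xs) (there m) with y ≟ a
  ... | yes _ = λ ()
  ... | no _ = ∈⇒count≢0 a xs m

  ∉⇒count≡0 : (a : A) (xs : List A) → a ∉ xs → count a xs ≡ 0
  ∉⇒count≡0 a [] _ = refl
  ∉⇒count≡0 a (y ∷ xs) a∉ with y ≟ a
  ... | yes refl = ⊥-elim (a∉ (here refl))
  ... | no _ = ∉⇒count≡0 a xs (a∉ ∘ there)

  count-≗⇒↭ : (xs ys : List A) → (∀ a → count a xs ≡ count a ys) → xs ↭ ys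
  count-≗⇒↭ [] [] e = ↭-refl
  count-≗⇒↭ [] (y ∷ ys) e = ⊥-elim (∈⇒count≢0 y (y ∷ ys) (here refl) (sym (e y)))
  count-≗⇒↭ (x ∷ xs) ys e with ∈-∃++ (count≢0⇒∈ x ys (λ c≡0 → ∈⇒count≢0 x (x ∷ xs) (here refl) (trans (e x) c≡0)))
  ... | as , bs , refl = ↭-trans (prep x (count-≗⇒↭ xs (as ++ bs) e′)) (↭-sym (shift x as bs))
    where
    e′ : ∀ a → count a xs ≡ count a (as ++ bs)
    e′ a = +-cancelˡ-≡ (if x == a then 1 else 0) _ _ (begin
      (if x == a then 1 else 0) + count a xs    ≡⟨ sym (count-∷ a x xs) ⟩
      count a (x ∷ xs)                           ≡⟨ e a ⟩
      count a (as ++ x ∷ bs)                     ≡⟨ count-++ a as (x ∷ bs) ⟩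
      count a as + count a (x ∷ bs)              ≡⟨ cong (count a as +_) (count-∷ a x bs) ⟩
      count a as + ((if x == a then 1 else 0) + count a bs)  ≡⟨ x∙yz≈y∙xz (count a as) (if x == a then 1 else 0) (count a bs) ⟩
      (if x == a then 1 else 0) + (count a as + count a bs)  ≡⟨ cong (_ +_) (sym (count-++ a as bs)) ⟩
      (if x == a then 1 else 0) + count a (as ++ bs)         ∎)
      where open ≡-Reasoning

  private
    ∈-remove : {y x : A} (as bs : List A) → y ∈ as ++ x ∷ bs → ¬ y ≡ x → y ∈ as ++ bs
    ∈-remove [] bs (here refl) y≢x = ⊥-elim (y≢x refl)
    ∈-remove [] bs (there m) y≢x = m
    ∈-remove (a ∷ as) bs (here refl) y≢x = here refl
    ∈-remove (a ∷ as) bs (there m) y≢x = there (∈-remove as bs m y≢x)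

  unique⇒length≤ : (xs ys : List A) → Unique xs → (∀ {x} → x ∈ xs → x ∈ ys) → length xs ≤ length ys
  unique⇒length≤ [] ys u sub = z≤n
  unique⇒length≤ (x ∷ xs) ys (x∉xs ∷ u) sub with ∈-∃++ (sub (here refl))
  ... | as , bs , refl = begin
      suc (length xs)              ≤⟨ s≤s (unique⇒length≤ xs (as ++ bs) u sub′) ⟩
      suc (length (as ++ bs))      ≡⟨ cong suc (length-++ as) ⟩
      suc (length as + length bs)  ≡⟨ sym (+-suc (length as) (length bs)) ⟩
      length as + length (x ∷ bs)  ≡⟨ sym (length-++ as) ⟩
      length (as ++ x ∷ bs)        ∎
    where
    open ≤-Reasoning
    sub′ : ∀ {y} → y ∈ xs → y ∈ as ++ bs
    sub′ m = ∈-remove as bs (sub (there m)) (λ y≡x → All.lookup x∉xs m (sym y≡x))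

  unique⇒count≤1 : (a : A) (xs : List A) → Unique xs → count a xs ≤ 1
  unique⇒count≤1 a xs u =
    unique⇒length≤ (filterᵇ (_== a) xs) [ a ] (unique-filterᵇ _ u)
      (λ m → here (==⇒≡ (proj₂ (∈-filterᵇ⁻ _ xs m))))

  unique-∈⇒count≡1 : (a : A) (xs : List A) → Unique xs → a ∈ xs → count a xs ≡ 1
  unique-∈⇒count≡1 a xs u m with count a xs | unique⇒count≤1 a xs u | ∈⇒count≢0 a xs m
  ... | zero | _ | c≢0 = ⊥-elim (c≢0 refl)
  ... | suc zero | _ | _ = refl
  ... | suc (suc _) | s≤s () | _

  concatMap-select : {B : Set} (f : A → List B) (x : A) (xs : List A) → Unique xs → x ∈ xs →
                     concatMap (λ y → if y == x then f y else []) xs ≡ f x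
  concatMap-select f x (y ∷ xs) (x∉xs ∷ u) (here refl) rewrite ==-refl y =
    trans (cong (f y ++_) (none xs (λ m → All.lookup x∉xs m refl))) (++-identityʳ (f y))
    where
    none : (zs : List A) → y ∉ zs → concatMap (λ z → if z == y then f z else []) zs ≡ []
    none [] _ = refl
    none (z ∷ zs) y∉ with z ≟ y
    ... | yes refl = ⊥-elim (y∉ (here refl))
    ... | no _ = none zs (y∉ ∘ there)
  concatMap-select f x (y ∷ xs) (y∉xs ∷ u) (there m) with y ≟ x
  ... | yes refl = ⊥-elim (All.lookup y∉xs m refl)
  ... | no _ = concatMap-select f x xs u m

  sum-count : (xs : List A) → Unique xs → (∀ x → x ∈ xs) → (σ : List A) →
              sum (map (λ a → count a σ) xs) ≡ length σ
  sum-count xs u all [] = sum-map-zero xs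
  sum-count xs u all (y ∷ σ) = begin
    sum (map (λ a → count a (y ∷ σ)) xs)                          ≡⟨ cong sum (map-cong (λ a → count-∷ a y σ) xs) ⟩
    sum (map (λ a → δ a + count a σ) xs)                          ≡⟨ sum-map-+ δ (λ a → count a σ) xs ⟩
    sum (map δ xs) + sum (map (λ a → count a σ) xs)               ≡⟨ cong₂ _+_ sum-δ (sum-count xs u all σ) ⟩
    count y xs + length σ                                         ≡⟨ cong (_+ length σ) (unique-∈⇒count≡1 y xs u (all y)) ⟩
    suc (length σ)                                                ∎
    where
    open ≡-Reasoning
    δ : A → ℕ
    δ a = if y == a then 1 else 0
    sum-δ : sum (map δ xs) ≡ count y xs
    sum-δ = trans (cong sum (map-cong (λ a → cong (λ b → if b then 1 else 0) (==-sym y a)) xs)) (sum-indicator (_== y) xs)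

allOne : List ℕ → Bool
allOne [] = true
allOne (c ∷ cs) = (c ≡ᵇ 1) ∧ allOne cs

allOne⇒All≡1 : (cs : List ℕ) → allOne cs ≡ true → All (_≡ 1) cs
allOne⇒All≡1 [] _ = []
allOne⇒All≡1 (suc zero ∷ cs) e = refl ∷ allOne⇒All≡1 cs e

All≡1⇒allOne : {cs : List ℕ} → All (_≡ 1) cs → allOne cs ≡ true
All≡1⇒allOne [] = refl
All≡1⇒allOne (refl ∷ h) = All≡1⇒allOne h

sum<length⇒product≡0 : (cs : List ℕ) → suc (sum cs) ≤ length cs → product cs ≡ 0
sum<length⇒product≡0 (zero ∷ cs) _ = refl
sum<length⇒product≡0 (suc c ∷ cs) (s≤s lt) =
  trans (cong (suc c *_) (sum<length⇒product≡0 cs (≤-trans (s≤s (m≤n+m (sum cs) c)) lt))) (*-zeroʳ (suc c))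

-- Either every entry is 1, or one exceeds 1 and then, the sum being the length, another is 0.
product-sum≡length : (cs : List ℕ) → sum cs ≡ length cs → product cs ≡ (if allOne cs then 1 else 0)
product-sum≡length [] _ = refl
product-sum≡length (zero ∷ cs) _ = refl
product-sum≡length (suc zero ∷ cs) e = trans (+-identityʳ (product cs)) (product-sum≡length cs (suc-injective e))
product-sum≡length (suc (suc c) ∷ cs) e =
  trans (cong (suc (suc c) *_) (sum<length⇒product≡0 cs (≤-trans (s≤s (m≤n+m (sum cs) c)) (≤-reflexive (suc-injective e)))))
        (*-zeroʳ (suc (suc c)))

module FormalDerivative {X : Set} (_≟_ : DecidableEquality X) where
  open Counting _≟_

  ∂ : X → List X → List (List X)
  ∂ v [] = []
  ∂ v (x ∷ xs) = (if x == v then [ xs ] else []) ++ map (x ∷_) (∂ v xs)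

  ∂ₚ : X → List (List X) → List (List X)
  ∂ₚ v = concatMap (∂ v)

  ∂* : List X → List (List X) → List (List X)
  ∂* [] p = p
  ∂* (v ∷ vs) p = ∂ₚ v (∂* vs p)

  ∂*-concatMap : (vs : List X) (g : A → List (List X)) (xs : List A) →
                 ∂* vs (concatMap g xs) ≡ concatMap (∂* vs ∘ g) xs
  ∂*-concatMap [] g xs = refl
  ∂*-concatMap (v ∷ vs) g xs = trans (cong (∂ₚ v) (∂*-concatMap vs g xs)) (concatMap-concatMap (∂ v) (∂* vs ∘ g) xs)

  ∂*-linear : (vs : List X) (p : List (List X)) → ∂* vs p ≡ concatMap (λ m → ∂* vs [ m ]) p
  ∂*-linear vs p = trans (cong (∂* vs) (sym (concatMap-pure p))) (∂*-concatMap vs [_] p)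

  ∂*-↭ : (vs : List X) {p q : List (List X)} → p ↭ q → ∂* vs p ↭ ∂* vs q
  ∂*-↭ [] p↭q = p↭q
  ∂*-↭ (v ∷ vs) p↭q = concatMap-↭ (∂ v) (∂*-↭ vs p↭q)

  length-∂ : (v : X) (m : List X) → length (∂ v m) ≡ count v m
  length-∂ v [] = refl
  length-∂ v (x ∷ m) with x == v
  ... | true = cong suc (trans (length-map (x ∷_) (∂ v m)) (length-∂ v m))
  ... | false = trans (length-map (x ∷_) (∂ v m)) (length-∂ v m)

  ∂-removes : (v : X) (m : List X) → All (λ r → v ∷ r ↭ m) (∂ v m)
  ∂-removes v [] = []
  ∂-removes v (x ∷ m) = All.++⁺ here′ (All.map⁺ (All.map (λ v∷r↭m → ↭-trans (swap v x ↭-refl) (prep x v∷r↭m)) (∂-removes v m)))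
    where
    here′ : All (λ r → v ∷ r ↭ x ∷ m) (if x == v then [ m ] else [])
    here′ with x ≟ v
    ... | yes refl = ↭-refl ∷ []
    ... | no _ = []

  ∂*-removes : (vs m : List X) → All (λ r → vs ++ r ↭ m) (∂* vs [ m ])
  ∂*-removes [] m = ↭-refl ∷ []
  ∂*-removes (v ∷ vs) m = All-concatMap (∂ v) step (∂*-removes vs m)
    where
    step : ∀ {r} → vs ++ r ↭ m → All (λ r′ → v ∷ vs ++ r′ ↭ m) (∂ v r)
    step {r} vs++r↭m = All.map (λ v∷r′↭r → ↭-trans (↭-sym (shift v vs _)) (↭-trans (++⁺ˡ vs v∷r′↭r) vs++r↭m)) (∂-removes v r)

  length-∂*-distinct : (vs : List X) → Unique vs → (m : List X) →
                       length (∂* vs [ m ]) ≡ product (map (λ a → count a m) vs)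
  length-∂*-distinct [] u m = refl
  length-∂*-distinct (v ∷ vs) (v∉vs ∷ u) m = begin
    length (concatMap (∂ v) (∂* vs [ m ]))     ≡⟨ length-concatMap-const (∂ v) (count v m) (All.map length-∂-v (∂*-removes vs m)) ⟩
    length (∂* vs [ m ]) * count v m            ≡⟨ cong (_* count v m) (length-∂*-distinct vs u m) ⟩
    product (map (λ a → count a m) vs) * count v m  ≡⟨ *-comm _ (count v m) ⟩
    count v m * product (map (λ a → count a m) vs)  ∎
    where
    open ≡-Reasoning
    length-∂-v : ∀ {r} → vs ++ r ↭ m → length (∂ v r) ≡ count v m
    length-∂-v {r} vs++r↭m = begin
      length (∂ v r)             ≡⟨ length-∂ v r ⟩
      count v r                  ≡⟨ sym (cong (_+ count v r) (∉⇒count≡0 v vs (λ v∈vs → All.lookup v∉vs v∈vs refl))) ⟩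
      count v vs + count v r     ≡⟨ sym (count-++ v vs r) ⟩
      count v (vs ++ r)          ≡⟨ count-↭ v vs++r↭m ⟩
      count v m                  ∎

-- The chain rule for the substitution a ↦ Σ_{lab b = a} b, which expands a monomial over A
-- into all monomials over B lying above it.
module Relabelling {A B : Set} (_≟ᴬ_ : DecidableEquality A) (_≟ᴮ_ : DecidableEquality B)
                   (lab : B → A) (univ : List B) (univ-unique : Unique univ) (∈-univ : ∀ b → b ∈ univ) where
  module CA = Counting _≟ᴬ_
  module CB = Counting _≟ᴮ_
  module DA = FormalDerivative _≟ᴬ_
  module DB = FormalDerivative _≟ᴮ_

  fibre : A → List B
  fibre v = filterᵇ (λ b → lab b CA.== v) univ

  expand : List A → List (List B)
  expand [] = [ [] ]
  expand (v ∷ vs) = concatMap (λ b → map (b ∷_) (expand vs)) (fibre v)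

  expandₚ : List (List A) → List (List B)
  expandₚ = concatMap expand

  private
    concatMap-if-[_] : (c : Bool) (S : List (List B)) → concatMap (λ s → if c then [ s ] else []) S ≡ (if c then S else [])
    concatMap-if-[ true ] S = concatMap-pure S
    concatMap-if-[ false ] S = concatMap-[] S

    if-if : (p q : Bool) (S : List (List B)) →
      (if p then (if q then S else []) else []) ≡ (if q then (if p then S else []) else [])
    if-if true q S = refl
    if-if false true S = refl
    if-if false false S = refl

    expandₚ-if : (c : Bool) (vs : List A) → expandₚ (if c then [ vs ] else []) ≡ (if c then expand vs else [])
    expandₚ-if true vs = ++-identityʳ _
    expandₚ-if false vs = refl

  ∂-expand : (a : B) (m : List A) → DB.∂ₚ a (expand m) ↭ expandₚ (DA.∂ (lab a) m)
  ∂-expand a [] = ↭-refl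
  -- The product rule: ∂_a either hits the first factor b, which survives only for b = a, or the rest.
  ∂-expand a (v ∷ vs) = begin
    DB.∂ₚ a (concatMap (λ b → map (b ∷_) S) (fibre v))
      ≡⟨ trans (concatMap-concatMap (DB.∂ a) (λ b → map (b ∷_) S) (fibre v))
               (concatMap-cong (λ b → concatMap-map (DB.∂ a) (b ∷_) S) (fibre v)) ⟩
    concatMap (λ b → concatMap (λ s → (if b CB.== a then [ s ] else []) ++ map (b ∷_) (DB.∂ a s)) S) (fibre v)
      ↭⟨ ↭-trans (concatMap-↭-pointwise (λ b → concatMap-++-↭ _ _ S) (fibre v)) (concatMap-++-↭ _ _ (fibre v)) ⟩
    concatMap (λ b → concatMap (λ s → if b CB.== a then [ s ] else []) S) (fibre v)
      ++ concatMap (λ b → concatMap (λ s → map (b ∷_) (DB.∂ a s)) S) (fibre v)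
      ↭⟨ ++⁺ (↭-reflexive differentiated) undifferentiated ⟩
    (if lab a CA.== v then S else []) ++ concatMap (λ r → expand (v ∷ r)) R
      ≡⟨ cong₂ _++_ (trans (expandₚ-if _ vs) (cong (λ c → if c then S else []) (CA.==-sym v (lab a))))
                    (concatMap-map expand (v ∷_) R) ⟨
    expandₚ (if v CA.== lab a then [ vs ] else []) ++ expandₚ (map (v ∷_) R)
      ≡⟨ concatMap-++ expand (if v CA.== lab a then [ vs ] else []) (map (v ∷_) R) ⟨
    expandₚ (DA.∂ (lab a) (v ∷ vs)) ∎
    where
    open PermutationReasoning
    S : List (List B)
    S = expand vs
    R : List (List A)
    R = DA.∂ (lab a) vs
    differentiated : concatMap (λ b → concatMap (λ s → if b CB.== a then [ s ] else []) S) (fibre v)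
                     ≡ (if lab a CA.== v then S else [])
    differentiated = trans (concatMap-filterᵇ _ (λ b → lab b CA.== v) univ)
      (trans (concatMap-cong (λ b → trans (cong (λ z → if lab b CA.== v then z else []) (concatMap-if-[ b CB.== a ] S))
                                          (if-if (lab b CA.== v) (b CB.== a) S)) univ)
             (CB.concatMap-select (λ b → if lab b CA.== v then S else []) a univ univ-unique (∈-univ a)))
    undifferentiated : concatMap (λ b → concatMap (λ s → map (b ∷_) (DB.∂ a s)) S) (fibre v)
                       ↭ concatMap (λ r → expand (v ∷ r)) R
    undifferentiated = begin
      concatMap (λ b → concatMap (λ s → map (b ∷_) (DB.∂ a s)) S) (fibre v)
        ≡⟨ concatMap-cong (λ b → map-concatMap (b ∷_) (DB.∂ a) S) (fibre v) ⟨
      concatMap (λ b → map (b ∷_) (DB.∂ₚ a S)) (fibre v)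
        ↭⟨ concatMap-↭-pointwise (λ b → map⁺ (b ∷_) (∂-expand a vs)) (fibre v) ⟩
      concatMap (λ b → map (b ∷_) (expandₚ R)) (fibre v)
        ≡⟨ concatMap-cong (λ b → map-concatMap (b ∷_) expand R) (fibre v) ⟩
      concatMap (λ b → concatMap (λ r → map (b ∷_) (expand r)) R) (fibre v)
        ↭⟨ concatMap-comm-↭ (λ b r → map (b ∷_) (expand r)) (fibre v) R ⟩
      concatMap (λ r → expand (v ∷ r)) R ∎

  ∂*-expand : (as : List B) (p : List (List A)) → DB.∂* as (expandₚ p) ↭ expandₚ (DA.∂* (map lab as) p)
  ∂*-expand [] p = ↭-refl
  ∂*-expand (a ∷ as) p = begin
    DB.∂ₚ a (DB.∂* as (expandₚ p))          ↭⟨ concatMap-↭ (DB.∂ a) (∂*-expand as p) ⟩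
    DB.∂ₚ a (expandₚ q)                     ≡⟨ concatMap-concatMap (DB.∂ a) expand q ⟩
    concatMap (λ m → DB.∂ₚ a (expand m)) q  ↭⟨ concatMap-↭-pointwise (∂-expand a) q ⟩
    concatMap (λ m → expandₚ (DA.∂ (lab a) m)) q  ≡⟨ concatMap-concatMap expand (DA.∂ (lab a)) q ⟨
    expandₚ (DA.∂ₚ (lab a) q)               ∎
    where
    open PermutationReasoning
    q : List (List A)
    q = DA.∂* (map lab as) p

_≟ᵛ_ : ∀ {n} → DecidableEquality (Var n)
(x , y) ≟ᵛ (i , l) with x Fin.≟ i | y Fin.≟ l
... | yes refl | yes refl = yes refl
... | no x≢i | _ = no (x≢i ∘ cong proj₁)
... | yes _ | no y≢l = no (y≢l ∘ cong proj₂)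

module _ {n : ℕ} where
  open Counting (Fin._≟_ {n})
  open Counting (_≟ᵛ_ {n}) using () renaming (_==_ to _==ᵛ_)
  open FormalDerivative (_≟ᵛ_ {n})

  ==ᵛ-∧ : (p : Var n) (i l : Fin n) → (p ==ᵛ (i , l)) ≡ (proj₁ p == i ∧ proj₂ p == l)
  ==ᵛ-∧ (x , y) i l with x Fin.≟ i | y Fin.≟ l
  ... | yes refl | yes refl = refl
  ... | no _ | _ = refl
  ... | yes refl | no _ = refl

  derivMono≡∂ : (v : Var n) (m : Monomial n) → derivMono v m ≡ ∂ v m
  derivMono≡∂ v [] = refl
  derivMono≡∂ (i , l) (x ∷ m) =
    cong₂ _++_ (cong (λ c → if c then [ m ] else []) (sym (==ᵛ-∧ x i l))) (cong (map (x ∷_)) (derivMono≡∂ (i , l) m))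

  applyOp≡∂* : (vs : List (Var n)) (p : Poly n) → applyOp vs p ≡ ∂* vs p
  applyOp≡∂* [] p = refl
  applyOp≡∂* (v ∷ vs) p = trans (concatMap-cong (derivMono≡∂ v) (applyOp vs p)) (cong (∂ₚ v) (applyOp≡∂* vs p))

  length-walks : (k : ℕ) (i j : Fin n) → All (λ m → length m ≡ k) (walks k i j)
  length-walks zero i j with i == j
  ... | true = refl ∷ []
  ... | false = []
  length-walks (suc k) i j = All-concatMap⁺ _ (allFin n) (λ l → All.map⁺ (All.map (cong suc) (length-walks k l j)))

  length-trPow : (k : ℕ) → All (λ m → length m ≡ k) (trPow n k)
  length-trPow k = All-concatMap⁺ _ (allFin n) (λ i → length-walks k i i)

-- A nonempty D is written d₀ ∷ D′ so that its arcs Fin N contain arc 0, the anchor for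
-- choosing one rotation of each circuit.
module Arcs {n : ℕ} (d₀ : Var n) (D′ : List (Var n)) where
  D : List (Var n)
  D = d₀ ∷ D′

  N : ℕ
  N = suc (length D′)

  arc : Fin N → Var n
  arc = lookup D

  src tgt : Fin N → Fin n
  src b = proj₁ (arc b)
  tgt b = proj₂ (arc b)

  map-arc-allFin : map arc (allFin N) ≡ D
  map-arc-allFin = trans (map-tabulate (λ x → x) arc) (tabulate-lookup D)

  open Counting (Fin._≟_ {n}) public
  module Arc = Counting (Fin._≟_ {N})

  words : ℕ → List (List (Fin N))
  words zero = [ [] ]
  words (suc k) = concatMap (λ b → map (b ∷_) (words k)) (allFin N)

  length-words : (k : ℕ) → All (λ σ → length σ ≡ k) (words k)
  length-words zero = refl ∷ []
  length-words (suc k) = All-concatMap⁺ _ (allFin N) (λ _ → All.map⁺ (All.map (cong suc) (length-words k)))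

  isWalk : Fin n → Fin n → List (Fin N) → Bool
  isWalk i j [] = i == j
  isWalk i j (b ∷ σ) = src b == i ∧ isWalk (tgt b) j σ

  isClosedWalk : List (Fin N) → Bool
  isClosedWalk [] = false
  isClosedWalk (b ∷ σ) = isWalk (tgt b) (src b) σ

  usesEachArcOnce : List (Fin N) → Bool
  usesEachArcOnce σ = allOne (map (λ b → Arc.count b σ) (allFin N))

  -- Euler circuits of D together with a choice of first arc.
  rootedCircuits : List (List (Fin N))
  rootedCircuits = filterᵇ usesEachArcOnce (filterᵇ isClosedWalk (words N))

  arc-onto : {x : Var n} → x ∈ D → Σ (Fin N) λ a → arc a ≡ x
  arc-onto {x} m with ∈-map⁻ arc {xs = allFin N} (subst (x ∈_) (sym map-arc-allFin) m)
  ... | a , _ , x≡ = a , sym x≡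

  isVertex-src : (a : Fin N) → IsVertex D (src a)
  isVertex-src a = inj₁ (Any.map (λ x≡ → cong proj₁ (sym x≡)) (∈-lookup a))

module TraceDerivative {n : ℕ} (d₀ : Var n) (D′ : List (Var n)) where
  open Arcs d₀ D′
  open Counting (_≟ᵛ_ {n}) using () renaming (_==_ to _==ᵛ_)
  module DV = FormalDerivative (_≟ᵛ_ {n})
  open Relabelling (_≟ᵛ_ {n}) (Fin._≟_ {N}) arc (allFin N) (Unique.allFin⁺ N) ∈-allFin

  filterᵇ-isWalk-words : (k : ℕ) (i j : Fin n) → filterᵇ (isWalk i j) (words (suc k)) ≡
    concatMap (λ b → if src b == i then map (b ∷_) (filterᵇ (isWalk (tgt b) j) (words k)) else []) (allFin N)
  filterᵇ-isWalk-words k i j =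
    trans (filterᵇ-concatMap (isWalk i j) (λ b → map (b ∷_) (words k)) (allFin N))
          (concatMap-cong (λ b → trans (filterᵇ-map (isWalk i j) (b ∷_) (words k)) (first-arc b)) (allFin N))
    where
    first-arc : ∀ b → map (b ∷_) (filterᵇ (λ σ → src b == i ∧ isWalk (tgt b) j σ) (words k))
                      ≡ (if src b == i then map (b ∷_) (filterᵇ (isWalk (tgt b) j) (words k)) else [])
    first-arc b with src b == i
    ... | true = refl
    ... | false = cong (map (b ∷_)) (filterᵇ-false (words k))

  private
    select-target : (b : Fin N) (i : Fin n) (X : Fin n → List (List (Fin N))) →
      concatMap (λ l → if arc b ==ᵛ (i , l) then X l else []) (allFin n) ≡ (if src b == i then X (tgt b) else [])
    select-target b i X =
      trans (concatMap-cong (λ l → cong (λ c → if c then X l else []) (==ᵛ-∧ (arc b) i l)) (allFin n)) (by-source (src b == i))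
      where
      by-source : (c : Bool) → concatMap (λ l → if c ∧ tgt b == l then X l else []) (allFin n) ≡ (if c then X (tgt b) else [])
      by-source true = trans (concatMap-cong (λ l → cong (λ z → if z then X l else []) (==-sym (tgt b) l)) (allFin n))
                             (concatMap-select X (tgt b) (allFin n) (Unique.allFin⁺ n) (∈-allFin (tgt b)))
      by-source false = concatMap-[] (allFin n)

    select-source : (b : Fin N) (Y : Fin n → List (List (Fin N))) →
      concatMap (λ i → if src b == i then Y i else []) (allFin n) ≡ Y (src b)
    select-source b Y = trans (concatMap-cong (λ i → cong (λ z → if z then Y i else []) (==-sym (src b) i)) (allFin n))
                              (concatMap-select Y (src b) (allFin n) (Unique.allFin⁺ n) (∈-allFin (src b)))

  expand-walks : (k : ℕ) (i j : Fin n) → expandₚ (walks k i j) ↭ filterᵇ (isWalk i j) (words k)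
  expand-walks zero i j with i Fin.≟ j
  ... | yes _ = ↭-refl
  ... | no _ = ↭-refl
  expand-walks (suc k) i j = begin
    expandₚ (concatMap (λ l → map ((i , l) ∷_) (walks k l j)) (allFin n))
      ≡⟨ trans (concatMap-concatMap expand _ (allFin n)) (concatMap-cong (λ l → concatMap-map expand _ (walks k l j)) (allFin n)) ⟩
    concatMap (λ l → concatMap (λ w → concatMap (λ b → map (b ∷_) (expand w)) (fibre (i , l))) (walks k l j)) (allFin n)
      ↭⟨ concatMap-↭-pointwise (λ l → concatMap-comm-↭ (λ w b → map (b ∷_) (expand w)) (walks k l j) (fibre (i , l))) (allFin n) ⟩
    concatMap (λ l → concatMap (λ b → concatMap (λ w → map (b ∷_) (expand w)) (walks k l j)) (fibre (i , l))) (allFin n)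
      ↭⟨ concatMap-↭-pointwise (λ l → concatMap-↭-pointwise (λ b → extend b l) (fibre (i , l))) (allFin n) ⟩
    concatMap (λ l → concatMap (λ b → map (b ∷_) (F l)) (fibre (i , l))) (allFin n)
      ≡⟨ concatMap-cong (λ l → concatMap-filterᵇ (λ b → map (b ∷_) (F l)) (λ b → arc b ==ᵛ (i , l)) (allFin N)) (allFin n) ⟩
    concatMap (λ l → concatMap (λ b → if arc b ==ᵛ (i , l) then map (b ∷_) (F l) else []) (allFin N)) (allFin n)
      ↭⟨ concatMap-comm-↭ (λ l b → if arc b ==ᵛ (i , l) then map (b ∷_) (F l) else []) (allFin n) (allFin N) ⟩
    concatMap (λ b → concatMap (λ l → if arc b ==ᵛ (i , l) then map (b ∷_) (F l) else []) (allFin n)) (allFin N)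
      ≡⟨ concatMap-cong (λ b → select-target b i (λ l → map (b ∷_) (F l))) (allFin N) ⟩
    concatMap (λ b → if src b == i then map (b ∷_) (F (tgt b)) else []) (allFin N)
      ≡⟨ filterᵇ-isWalk-words k i j ⟨
    filterᵇ (isWalk i j) (words (suc k)) ∎
    where
    open PermutationReasoning
    F : Fin n → List (List (Fin N))
    F l = filterᵇ (isWalk l j) (words k)
    extend : ∀ b l → concatMap (λ w → map (b ∷_) (expand w)) (walks k l j) ↭ map (b ∷_) (F l)
    extend b l = ↭-trans (↭-reflexive (sym (map-concatMap (b ∷_) expand (walks k l j)))) (map⁺ (b ∷_) (expand-walks k l j))

  expand-trPow : (k : ℕ) → expandₚ (trPow n (suc k)) ↭ filterᵇ isClosedWalk (words (suc k))
  expand-trPow k = begin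
    expandₚ (concatMap (λ i → walks (suc k) i i) (allFin n))
      ≡⟨ concatMap-concatMap expand (λ i → walks (suc k) i i) (allFin n) ⟩
    concatMap (λ i → expandₚ (walks (suc k) i i)) (allFin n)
      ↭⟨ concatMap-↭-pointwise (λ i → expand-walks (suc k) i i) (allFin n) ⟩
    concatMap (λ i → filterᵇ (isWalk i i) (words (suc k))) (allFin n)
      ≡⟨ concatMap-cong (λ i → filterᵇ-isWalk-words k i i) (allFin n) ⟩
    concatMap (λ i → concatMap (λ b → if src b == i then map (b ∷_) (F b i) else []) (allFin N)) (allFin n)
      ↭⟨ concatMap-comm-↭ (λ i b → if src b == i then map (b ∷_) (F b i) else []) (allFin n) (allFin N) ⟩
    concatMap (λ b → concatMap (λ i → if src b == i then map (b ∷_) (F b i) else []) (allFin n)) (allFin N)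
      ≡⟨ concatMap-cong (λ b → select-source b (λ i → map (b ∷_) (F b i))) (allFin N) ⟩
    concatMap (λ b → map (b ∷_) (F b (src b))) (allFin N)
      ≡⟨ concatMap-cong (λ b → filterᵇ-map isClosedWalk (b ∷_) (words k)) (allFin N) ⟨
    concatMap (λ b → filterᵇ isClosedWalk (map (b ∷_) (words k))) (allFin N)
      ≡⟨ filterᵇ-concatMap isClosedWalk (λ b → map (b ∷_) (words k)) (allFin N) ⟨
    filterᵇ isClosedWalk (words (suc k)) ∎
    where
    open PermutationReasoning
    F : Fin N → Fin n → List (List (Fin N))
    F b i = filterᵇ (isWalk (tgt b) i) (words k)

  -- Differentiating once in every arc kills a word of length N unless it uses each arc once.
  length-∂*-closedWalks : length (DB.∂* (allFin N) (filterᵇ isClosedWalk (words N))) ≡ length rootedCircuits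
  length-∂*-closedWalks =
    trans (cong length (DB.∂*-linear (allFin N) (filterᵇ isClosedWalk (words N))))
          (length-concatMap-indicator (λ m → DB.∂* (allFin N) [ m ]) usesEachArcOnce
             (All.map terms (All-filterᵇ isClosedWalk (length-words N))))
    where
    terms : ∀ {m} → length m ≡ N → length (DB.∂* (allFin N) [ m ]) ≡ (if usesEachArcOnce m then 1 else 0)
    terms {m} len = trans (DB.length-∂*-distinct (allFin N) (Unique.allFin⁺ N) m)
      (product-sum≡length (map (λ b → Arc.count b m) (allFin N))
        (trans (Arc.sum-count (allFin N) (Unique.allFin⁺ N) ∈-allFin m)
               (trans len (sym (trans (length-map _ (allFin N)) (length-allFin N))))))

  ∂*-trPow-constant : All (_≡ []) (DV.∂* D (trPow n N))
  ∂*-trPow-constant rewrite DV.∂*-linear D (trPow n N) =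
    All-concatMap (λ m → DV.∂* D [ m ]) (λ {m} len → All.map (constant len) (DV.∂*-removes D m)) (length-trPow N)
    where
    constant : ∀ {m r} → length m ≡ N → D ++ r ↭ m → r ≡ []
    constant {r = []} _ _ = refl
    constant {m} {r ∷ rs} len D++r↭m = ⊥-elim (1+n≰n (begin
      suc N                      ≤⟨ m≤m+n (suc N) (length rs) ⟩
      suc N + length rs          ≡⟨ +-suc N (length rs) ⟨
      N + length (r ∷ rs)        ≡⟨ length-++ D ⟨
      length (D ++ r ∷ rs)       ≡⟨ ↭-length D++r↭m ⟩
      length m                   ≡⟨ len ⟩
      N                          ∎))
      where open ≤-Reasoning

  length-expandₚ-constants : (p : Poly n) → All (_≡ []) p → length (expandₚ p) ≡ length p
  length-expandₚ-constants p consts =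
    trans (length-concatMap-const expand 1 (All.map (λ { refl → refl }) consts)) (*-identityʳ (length p))

  applyOp-trPow : All (_≡ []) (applyOp D (trPow n N)) × length (applyOp D (trPow n N)) ≡ length rootedCircuits
  applyOp-trPow rewrite applyOp≡∂* D (trPow n N) =
    ∂*-trPow-constant ,
    (begin
      length (DV.∂* D (trPow n N))                               ≡⟨ sym (length-expandₚ-constants _ ∂*-trPow-constant) ⟩
      length (expandₚ (DV.∂* D (trPow n N)))                     ≡⟨ ↭-length (↭-sym relabel) ⟩
      length (DB.∂* (allFin N) (expandₚ (trPow n N)))            ≡⟨ ↭-length (DB.∂*-↭ (allFin N) (expand-trPow (length D′))) ⟩
      length (DB.∂* (allFin N) (filterᵇ isClosedWalk (words N))) ≡⟨ length-∂*-closedWalks ⟩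
      length rootedCircuits                                       ∎)
    where
    open ≡-Reasoning
    relabel : DB.∂* (allFin N) (expandₚ (trPow n N)) ↭ expandₚ (DV.∂* D (trPow n N))
    relabel = subst (λ z → DB.∂* (allFin N) (expandₚ (trPow n N)) ↭ expandₚ (DV.∂* z (trPow n N))) map-arc-allFin
                    (∂*-expand (allFin N) (trPow n N))

module RootedCircuits {n : ℕ} (d₀ : Var n) (D′ : List (Var n)) where
  open Arcs d₀ D′

  words-complete : (σ : List (Fin N)) → σ ∈ words (length σ)
  words-complete [] = here refl
  words-complete (b ∷ σ) = ∈-concatMap⁺ (λ b′ → map (b′ ∷_) (words (length σ))) (Any.map (λ { refl → ∈-map⁺ (b ∷_) (words-complete σ) }) (∈-allFin b))

  usesEachArcOnce⇒count≡1 : (σ : List (Fin N)) → usesEachArcOnce σ ≡ true → ∀ b → Arc.count b σ ≡ 1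
  usesEachArcOnce⇒count≡1 σ e b = All.lookup (All.map⁻ (allOne⇒All≡1 _ e)) (∈-allFin b)

  usesEachArcOnce⇒↭ : (σ : List (Fin N)) → usesEachArcOnce σ ≡ true → σ ↭ allFin N
  usesEachArcOnce⇒↭ σ e = Arc.count-≗⇒↭ σ (allFin N) λ b →
    trans (usesEachArcOnce⇒count≡1 σ e b) (sym (Arc.unique-∈⇒count≡1 b (allFin N) (Unique.allFin⁺ N) (∈-allFin b)))

  ↭⇒usesEachArcOnce : (σ : List (Fin N)) → σ ↭ allFin N → usesEachArcOnce σ ≡ true
  ↭⇒usesEachArcOnce σ σ↭ = All≡1⇒allOne (All.map⁺ (All.tabulate {xs = allFin N} λ {b} _ →
    trans (Arc.count-↭ b σ↭) (Arc.unique-∈⇒count≡1 b (allFin N) (Unique.allFin⁺ N) (∈-allFin b))))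

  isWalk⇒Chain : (x : Var n) (σ : List (Fin N)) (c : Fin N) → isWalk (proj₂ x) (src c) σ ≡ true →
                 Chain (x ∷ map arc σ ++ arc c ∷ [])
  isWalk⇒Chain x [] c e = ==⇒≡ e , tt
  isWalk⇒Chain x (b ∷ σ) c e with ∧≡true⁻ {src b == proj₂ x} e
  ... | e₁ , e₂ = sym (==⇒≡ e₁) , isWalk⇒Chain (arc b) σ c e₂

  Chain⇒isWalk : (x : Var n) (σ : List (Fin N)) (c : Fin N) → Chain (x ∷ map arc σ ++ arc c ∷ []) →
                 isWalk (proj₂ x) (src c) σ ≡ true
  Chain⇒isWalk x [] c (e , _) = ≡⇒== e
  Chain⇒isWalk x (b ∷ σ) c (e , ch) = ∧≡true⁺ (≡⇒== (sym e)) (Chain⇒isWalk (arc b) σ c ch)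

  isClosedWalk⇒CyclicChain : (σ : List (Fin N)) → isClosedWalk σ ≡ true → CyclicChain (map arc σ)
  isClosedWalk⇒CyclicChain (b ∷ σ) e = isWalk⇒Chain (arc b) σ b e

  CyclicChain⇒isClosedWalk : (b : Fin N) (σ : List (Fin N)) → CyclicChain (map arc (b ∷ σ)) → isClosedWalk (b ∷ σ) ≡ true
  CyclicChain⇒isClosedWalk b σ c = Chain⇒isWalk (arc b) σ b c

  ∈-rootedCircuits⁻ : {σ : List (Fin N)} → σ ∈ rootedCircuits → (σ ↭ allFin N) × CyclicChain (map arc σ)
  ∈-rootedCircuits⁻ {σ} m with ∈-filterᵇ⁻ usesEachArcOnce (filterᵇ isClosedWalk (words N)) m
  ... | m′ , once = usesEachArcOnce⇒↭ σ once , isClosedWalk⇒CyclicChain σ (proj₂ (∈-filterᵇ⁻ isClosedWalk (words N) m′))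

  ∈-rootedCircuits⁺ : (σ : List (Fin N)) → σ ↭ allFin N → CyclicChain (map arc σ) → σ ∈ rootedCircuits
  ∈-rootedCircuits⁺ [] σ↭ c with ↭-length σ↭
  ... | ()
  ∈-rootedCircuits⁺ (b ∷ τ) σ↭ c =
    ∈-filterᵇ⁺ usesEachArcOnce (filterᵇ isClosedWalk (words N))
      (∈-filterᵇ⁺ isClosedWalk (words N)
        (subst (λ k → b ∷ τ ∈ words k) (trans (↭-length σ↭) (length-allFin N)) (words-complete (b ∷ τ)))
        (CyclicChain⇒isClosedWalk b τ c))
      (↭⇒usesEachArcOnce (b ∷ τ) σ↭)

  closedWalk-of : {σ : List (Fin N)} → σ ∈ rootedCircuits → isClosedWalk σ ≡ true
  closedWalk-of σ∈ = proj₂ (∈-filterᵇ⁻ isClosedWalk (words N) (proj₁ (∈-filterᵇ⁻ usesEachArcOnce (filterᵇ isClosedWalk (words N)) σ∈)))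

  rootedCircuit-count₁ : {σ : List (Fin N)} → σ ∈ rootedCircuits → ∀ b → Arc.count b σ ≡ 1
  rootedCircuit-count₁ {σ} m = usesEachArcOnce⇒count≡1 σ (proj₂ (∈-filterᵇ⁻ usesEachArcOnce (filterᵇ isClosedWalk (words N)) m))

  length-rootedCircuits : All (λ σ → length σ ≡ N) rootedCircuits
  length-rootedCircuits = All-filterᵇ usesEachArcOnce (All-filterᵇ isClosedWalk (length-words N))

  words-snoc : (k : ℕ) → words (suc k) ↭ concatMap (λ a → map (_++ [ a ]) (words k)) (allFin N)
  words-snoc zero = ↭-refl
  words-snoc (suc k) = begin
    concatMap (λ b → map (b ∷_) (words (suc k))) (allFin N)
      ↭⟨ concatMap-↭-pointwise (λ b → map⁺ (b ∷_) (words-snoc k)) (allFin N) ⟩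
    concatMap (λ b → map (b ∷_) (concatMap (λ a → map (_++ [ a ]) (words k)) (allFin N))) (allFin N)
      ≡⟨ concatMap-cong (λ b → map-concatMap (b ∷_) (λ a → map (_++ [ a ]) (words k)) (allFin N)) (allFin N) ⟩
    concatMap (λ b → concatMap (λ a → map (b ∷_) (map (_++ [ a ]) (words k))) (allFin N)) (allFin N)
      ↭⟨ concatMap-comm-↭ (λ b a → map (b ∷_) (map (_++ [ a ]) (words k))) (allFin N) (allFin N) ⟩
    concatMap (λ a → concatMap (λ b → map (b ∷_) (map (_++ [ a ]) (words k))) (allFin N)) (allFin N)
      ≡⟨ concatMap-cong (λ a → concatMap-cong (λ b → trans (sym (map-∘ (words k))) (map-∘ (words k))) (allFin N)) (allFin N) ⟩
    concatMap (λ a → concatMap (λ b → map (_++ [ a ]) (map (b ∷_) (words k))) (allFin N)) (allFin N)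
      ≡⟨ concatMap-cong (λ a → map-concatMap (_++ [ a ]) (λ b → map (b ∷_) (words k)) (allFin N)) (allFin N) ⟨
    concatMap (λ a → map (_++ [ a ]) (words (suc k))) (allFin N) ∎
    where open PermutationReasoning

  map-rot-words : map rot (words N) ↭ words N
  map-rot-words = begin
    map rot (concatMap (λ b → map (b ∷_) (words (length D′))) (allFin N))
      ≡⟨ map-concatMap rot (λ b → map (b ∷_) (words (length D′))) (allFin N) ⟩
    concatMap (λ b → map rot (map (b ∷_) (words (length D′)))) (allFin N)
      ≡⟨ concatMap-cong (λ b → map-∘ (words (length D′))) (allFin N) ⟨
    concatMap (λ b → map (_++ [ b ]) (words (length D′))) (allFin N)
      ↭⟨ words-snoc (length D′) ⟨
    words N ∎
    where open PermutationReasoning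

  isWalk-snoc : (i j : Fin n) (σ : List (Fin N)) (b : Fin N) → isWalk i j (σ ++ [ b ]) ≡ (isWalk i (src b) σ ∧ tgt b == j)
  isWalk-snoc i j [] b = cong (_∧ tgt b == j) (==-sym (src b) i)
  isWalk-snoc i j (x ∷ σ) b = trans (cong (src x == i ∧_) (isWalk-snoc (tgt x) j σ b)) (sym (∧-assoc (src x == i) _ _))

  isClosedWalk-rot : (σ : List (Fin N)) → isClosedWalk (rot σ) ≡ isClosedWalk σ
  isClosedWalk-rot [] = refl
  isClosedWalk-rot (b ∷ []) = refl
  isClosedWalk-rot (b ∷ c ∷ σ) = trans (isWalk-snoc (tgt c) (src c) σ b)
     (trans (∧-comm (isWalk (tgt c) (src b) σ) _) (cong (_∧ isWalk (tgt c) (src b) σ) (==-sym (tgt b) (src c))))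

  usesEachArcOnce-rot : (σ : List (Fin N)) → usesEachArcOnce (rot σ) ≡ usesEachArcOnce σ
  usesEachArcOnce-rot σ = cong allOne (map-cong (λ b → Arc.count-↭ b (rot-↭ σ)) (allFin N))

  map-rot-rootedCircuits : map rot rootedCircuits ↭ rootedCircuits
  map-rot-rootedCircuits =
    ↭-trans (↭-reflexive (trans (map-rot-filterᵇ usesEachArcOnce usesEachArcOnce-rot (filterᵇ isClosedWalk (words N)))
                                (cong (filterᵇ usesEachArcOnce) (map-rot-filterᵇ isClosedWalk isClosedWalk-rot (words N)))))
            (filterᵇ-↭ usesEachArcOnce (filterᵇ-↭ isClosedWalk map-rot-words))

  rotN∈rootedCircuits : (r : ℕ) {σ : List (Fin N)} → σ ∈ rootedCircuits → rotN r σ ∈ rootedCircuits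
  rotN∈rootedCircuits zero m = m
  rotN∈rootedCircuits (suc r) m = ∈-resp-↭ map-rot-rootedCircuits (∈-map⁺ rot (rotN∈rootedCircuits r m))

  unique-words : (k : ℕ) → Unique (words k)
  unique-words zero = [] ∷ []
  unique-words (suc k) = unique-prefixed (allFin N) (Unique.allFin⁺ N)
    where
    prefixed : List (Fin N) → List (List (Fin N))
    prefixed = concatMap (λ b → map (b ∷_) (words k))

    unique-prefixed : (bs : List (Fin N)) → Unique bs → Unique (prefixed bs)
    unique-prefixed [] _ = []
    unique-prefixed (b ∷ bs) (b∉bs ∷ u) =
      Unique.++⁺ (Unique.map⁺ ∷-injectiveʳ (unique-words k)) (unique-prefixed bs u) disjoint
      where
      disjoint : ∀ {w} → ¬ ((w ∈ map (b ∷_) (words k)) × (w ∈ prefixed bs))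
      disjoint (m₁ , m₂) with ∈-map⁻ (b ∷_) m₁
      ... | _ , _ , refl = All.lookup b∉bs (Any.map head (∈-concatMap⁻ (λ b′ → map (b′ ∷_) (words k)) {xs = bs} m₂)) refl
        where
        head : ∀ {b′ s} → b ∷ s ∈ map (b′ ∷_) (words k) → b ≡ b′
        head m with ∈-map⁻ _ m
        ... | _ , _ , e = ∷-injectiveˡ e

module RotationClasses {n : ℕ} (d₀ : Var n) (D′ : List (Var n)) where
  open Arcs d₀ D′
  open RootedCircuits d₀ D′

  startsWith₀ : List (Fin N) → Bool
  startsWith₀ [] = false
  startsWith₀ (b ∷ _) = b Arc.== zero

  circuits₀ : List (List (Fin N))
  circuits₀ = filterᵇ startsWith₀ rootedCircuits

  rotations₀ : ℕ → List (Fin N) → ℕ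
  rotations₀ zero σ = 0
  rotations₀ (suc k) σ = (if startsWith₀ σ then 1 else 0) + rotations₀ k (rot σ)

  rotations₀-++ : (xs ys : List (Fin N)) → rotations₀ (length xs) (xs ++ ys) ≡ Arc.count zero xs
  rotations₀-++ [] ys = refl
  rotations₀-++ (x ∷ xs) ys =
    trans (cong ((if x Arc.== zero then 1 else 0) +_)
                (trans (cong (rotations₀ (length xs)) (++-assoc xs ys [ x ])) (rotations₀-++ xs (ys ++ [ x ]))))
          (sym (Arc.count-∷ zero x xs))

  rotations₀-length : (σ : List (Fin N)) → rotations₀ (length σ) σ ≡ Arc.count zero σ
  rotations₀-length σ = trans (cong (rotations₀ (length σ)) (sym (++-identityʳ σ))) (rotations₀-++ σ [])

  -- Rotation permutes the rooted circuits, so every rotation index contributes |circuits₀|.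
  sum-rotations₀ : (k : ℕ) → sum (map (rotations₀ k) rootedCircuits) ≡ k * length circuits₀
  sum-rotations₀ zero = sum-map-zero rootedCircuits
  sum-rotations₀ (suc k) = begin
    sum (map (rotations₀ (suc k)) rootedCircuits)
      ≡⟨ sum-map-+ (λ σ → if startsWith₀ σ then 1 else 0) (rotations₀ k ∘ rot) rootedCircuits ⟩
    sum (map (λ σ → if startsWith₀ σ then 1 else 0) rootedCircuits) + sum (map (rotations₀ k ∘ rot) rootedCircuits)
      ≡⟨ cong₂ _+_ (sum-indicator startsWith₀ rootedCircuits) (cong sum (map-∘ rootedCircuits)) ⟩
    length circuits₀ + sum (map (rotations₀ k) (map rot rootedCircuits))
      ≡⟨ cong (length circuits₀ +_) (sum-↭ (map⁺ (rotations₀ k) map-rot-rootedCircuits)) ⟩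
    length circuits₀ + sum (map (rotations₀ k) rootedCircuits)
      ≡⟨ cong (length circuits₀ +_) (sum-rotations₀ k) ⟩
    length circuits₀ + k * length circuits₀ ∎
    where open ≡-Reasoning

  length-rootedCircuits≡N* : length rootedCircuits ≡ N * length circuits₀
  length-rootedCircuits≡N* = trans (sym (sum-map-ones (rotations₀ N) (All.tabulate once))) (sum-rotations₀ N)
    where
    once : ∀ {σ} → σ ∈ rootedCircuits → rotations₀ N σ ≡ 1
    once {σ} m = trans (cong (λ k → rotations₀ k σ) (sym (All.lookup length-rootedCircuits m)))
                       (trans (rotations₀-length σ) (rootedCircuit-count₁ m zero))

  splitAt₀ : List (Fin N) → List (Fin N) × List (Fin N)
  splitAt₀ [] = [] , []
  splitAt₀ (x ∷ s) = if x Arc.== zero then ([] , s) else (x ∷ proj₁ (splitAt₀ s) , proj₂ (splitAt₀ s))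

  canonical : List (Fin N) → List (Fin N)
  canonical σ = zero ∷ proj₂ (splitAt₀ σ) ++ proj₁ (splitAt₀ σ)

  splitAt₀-++ : (a b : List (Fin N)) → zero ∉ a → splitAt₀ (a ++ zero ∷ b) ≡ (a , b)
  splitAt₀-++ [] b _ rewrite Arc.==-refl (zero {length D′}) = refl
  splitAt₀-++ (x ∷ a) b 0∉ with x Fin.≟ zero
  ... | yes refl = ⊥-elim (0∉ (here refl))
  ... | no _ rewrite splitAt₀-++ a b (0∉ ∘ there) = refl

  canonical-++ : (a b : List (Fin N)) → zero ∉ a → canonical (a ++ zero ∷ b) ≡ zero ∷ b ++ a
  canonical-++ a b 0∉ rewrite splitAt₀-++ a b 0∉ = refl

  split₀ : (σ : List (Fin N)) → Arc.count zero σ ≡ 1 →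
           Σ (List (Fin N)) λ a → Σ (List (Fin N)) λ b → (σ ≡ a ++ zero ∷ b) × (zero ∉ a) × (zero ∉ b)
  split₀ σ once with ∈-∃++ (Arc.count≢0⇒∈ zero σ (λ c≡0 → 1≢0 (trans (sym once) c≡0)))
    where
    1≢0 : ¬ 1 ≡ 0
    1≢0 ()
  ... | a , b , refl = a , b , refl , absent a (proj₁ zeros) , absent b (proj₂ zeros)
    where
    absent : ∀ xs → Arc.count zero xs ≡ 0 → zero ∉ xs
    absent xs c≡0 m = Arc.∈⇒count≢0 zero xs m c≡0
    split-once : Arc.count zero a + suc (Arc.count zero b) ≡ 1
    split-once = trans (sym (trans (Arc.count-++ zero a (zero ∷ b)) (cong (Arc.count zero a +_)
                   (trans (Arc.count-∷ zero zero b) (cong (λ c → (if c then 1 else 0) + Arc.count zero b) (Arc.==-refl zero))))))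
                 once
    zeros : (Arc.count zero a ≡ 0) × (Arc.count zero b ≡ 0)
    zeros with Arc.count zero a | Arc.count zero b | split-once
    ... | zero | zero | _ = refl , refl
    ... | zero | suc _ | ()
    ... | suc p | q | e rewrite +-suc p q with suc-injective e
    ...   | ()

  canonical-rot : (σ : List (Fin N)) → Arc.count zero σ ≡ 1 → canonical (rot σ) ≡ canonical σ
  canonical-rot σ once with split₀ σ once
  ... | [] , b , refl , _ , 0∉b = trans (canonical-++ b [] 0∉b) (cong (zero ∷_) (sym (++-identityʳ b)))
  ... | x ∷ a , b , refl , 0∉xa , _ =
    trans (cong canonical (++-assoc a (zero ∷ b) [ x ]))
      (trans (canonical-++ a (b ++ [ x ]) (0∉xa ∘ there))
        (trans (cong (zero ∷_) (++-assoc b [ x ] a)) (sym (canonical-++ (x ∷ a) b 0∉xa))))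

  canonical-rotN : (r : ℕ) (σ : List (Fin N)) → Arc.count zero σ ≡ 1 → canonical (rotN r σ) ≡ canonical σ
  canonical-rotN zero σ once = refl
  canonical-rotN (suc r) σ once =
    trans (canonical-rot (rotN r σ) (trans (count-rotN r σ) once)) (canonical-rotN r σ once)
    where
    count-rotN : (r : ℕ) (σ : List (Fin N)) → Arc.count zero (rotN r σ) ≡ Arc.count zero σ
    count-rotN zero σ = refl
    count-rotN (suc r) σ = trans (Arc.count-↭ zero (rot-↭ (rotN r σ))) (count-rotN r σ)

  rotN-to-canonical : (σ : List (Fin N)) → Arc.count zero σ ≡ 1 → Σ ℕ λ r → rotN r σ ≡ canonical σ
  rotN-to-canonical σ once with split₀ σ once
  ... | a , b , refl , 0∉a , _ = length a , trans (rotN-++ a (zero ∷ b)) (sym (canonical-++ a b 0∉a))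

  rotN-from-canonical : (τ : List (Fin N)) → Arc.count zero τ ≡ 1 → Σ ℕ λ r → rotN r (canonical τ) ≡ τ
  rotN-from-canonical τ once with split₀ τ once
  ... | a , b , refl , 0∉a , _ =
    suc (length b) , trans (cong (rotN (suc (length b))) (canonical-++ a b 0∉a)) (rotN-++ (zero ∷ b) a)

  canonical⇒RotEq : (σ τ : List (Fin N)) → Arc.count zero σ ≡ 1 → Arc.count zero τ ≡ 1 →
                    canonical σ ≡ canonical τ → RotEq σ τ
  canonical⇒RotEq σ τ σ-once τ-once eq with rotN-to-canonical σ σ-once | rotN-from-canonical τ τ-once
  ... | r₁ , p₁ | r₂ , p₂ = r₂ + r₁ , trans (sym (rotN-+ r₂ r₁ σ)) (trans (cong (rotN r₂) (trans p₁ eq)) p₂)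

  RotEq⇒canonical : (σ τ : List (Fin N)) → Arc.count zero σ ≡ 1 → RotEq σ τ → canonical σ ≡ canonical τ
  RotEq⇒canonical σ τ once (r , refl) = sym (canonical-rotN r σ once)

  canonical∈circuits₀ : {σ : List (Fin N)} → σ ∈ rootedCircuits → canonical σ ∈ circuits₀
  canonical∈circuits₀ {σ} m with rotN-to-canonical σ (rootedCircuit-count₁ m zero)
  ... | r , p = ∈-filterᵇ⁺ startsWith₀ rootedCircuits (subst (_∈ rootedCircuits) p (rotN∈rootedCircuits r m)) (Arc.==-refl zero)

  canonical-circuits₀ : (τ : List (Fin N)) → τ ∈ circuits₀ → canonical τ ≡ τ
  canonical-circuits₀ [] m with () ← proj₂ (∈-filterᵇ⁻ startsWith₀ rootedCircuits m)
  canonical-circuits₀ (x ∷ b) m with x Fin.≟ zero | proj₂ (∈-filterᵇ⁻ startsWith₀ rootedCircuits m)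
  ... | yes refl | _ = trans (canonical-++ [] b (λ ())) (cong (zero ∷_) (++-identityʳ b))
  ... | no _ | ()

  ∈-rootedCircuits : (x : CircuitSeq D) → proj₁ x ∈ rootedCircuits
  ∈-rootedCircuits (σ , σ↭ , c) = ∈-rootedCircuits⁺ σ σ↭ c

  -- A circuit sequence is classified by the position of its canonical rotation in circuits₀.
  eulerCount : EulerCount D (length circuits₀)
  eulerCount = classify , onto , same-class⇔RotEq
    where
    classify : CircuitSeq D → Fin (length circuits₀)
    classify x = Any.index (canonical∈circuits₀ (∈-rootedCircuits x))

    unique-circuits₀ : Unique circuits₀
    unique-circuits₀ = unique-filterᵇ startsWith₀ (unique-filterᵇ usesEachArcOnce (unique-filterᵇ isClosedWalk (unique-words N)))

    index-cong : {τ τ′ : List (Fin N)} → τ ≡ τ′ → (m : τ ∈ circuits₀) (m′ : τ′ ∈ circuits₀) → Any.index m ≡ Any.index m′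
    index-cong refl = index-unique unique-circuits₀

    onto : ∀ j → ∃ λ x → classify x ≡ j
    onto j = x , trans (index-cong (canonical-circuits₀ τ τ∈) _ τ∈) (index-∈-lookup circuits₀ j)
      where
      τ : List (Fin N)
      τ = lookup circuits₀ j
      τ∈ : τ ∈ circuits₀
      τ∈ = ∈-lookup j
      x : CircuitSeq D
      x = τ , ∈-rootedCircuits⁻ (proj₁ (∈-filterᵇ⁻ startsWith₀ rootedCircuits τ∈))

    same-class⇔RotEq : ∀ x y → (classify x ≡ classify y) ⇔ RotEq (proj₁ x) (proj₁ y)
    same-class⇔RotEq x y = mk⇔
      (λ e → canonical⇒RotEq (proj₁ x) (proj₁ y) (once x) (once y)
               (trans (lookup-index (canonical∈circuits₀ (∈-rootedCircuits x)))
                 (trans (cong (lookup circuits₀) e) (sym (lookup-index (canonical∈circuits₀ (∈-rootedCircuits y)))))))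
      (λ r → index-cong (RotEq⇒canonical (proj₁ x) (proj₁ y) (once x) r) _ _)
      where
      once : (x : CircuitSeq D) → Arc.count zero (proj₁ x) ≡ 1
      once x = rootedCircuit-count₁ (∈-rootedCircuits x) zero

module Degrees {n : ℕ} (d₀ : Var n) (D′ : List (Var n)) where
  open Arcs d₀ D′

  outOf into : List (Fin N) → Fin n → ℕ
  outOf X v = length (filterᵇ (λ a → src a == v) X)
  into X v = length (filterᵇ (λ a → tgt a == v) X)

  δ : Fin n → Fin n → ℕ
  δ i v = if i == v then 1 else 0

  δ-self : (w : Fin n) → δ w w ≡ 1
  δ-self w rewrite ==-refl w = refl

  δ-≢ : {u w : Fin n} → ¬ w ≡ u → δ u w ≡ 0
  δ-≢ w≢u rewrite ≢⇒== (w≢u ∘ sym) = refl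

  private
    arcs-ending : (end : Var n → Fin n) (v : Fin n) →
                  length (filter (λ a → end a Fin.≟ v) D) ≡ length (filterᵇ (λ a → end (arc a) == v) (allFin N))
    arcs-ending end v = begin
      length (filter (λ a → end a Fin.≟ v) D)                     ≡⟨ cong length (filterᵇ-dec (λ a → end a Fin.≟ v) D) ⟩
      length (filterᵇ (λ a → end a == v) D)                        ≡⟨ cong (length ∘ filterᵇ (λ a → end a == v)) map-arc-allFin ⟨
      length (filterᵇ (λ a → end a == v) (map arc (allFin N)))     ≡⟨ cong length (filterᵇ-map (λ a → end a == v) arc (allFin N)) ⟩
      length (map arc (filterᵇ (λ a → end (arc a) == v) (allFin N)))  ≡⟨ length-map arc (filterᵇ (λ a → end (arc a) == v) (allFin N)) ⟩
      length (filterᵇ (λ a → end (arc a) == v) (allFin N))         ∎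
      where open ≡-Reasoning

  outdeg≡outOf : (v : Fin n) → outdeg D v ≡ outOf (allFin N) v
  outdeg≡outOf = arcs-ending proj₁

  indeg≡into : (v : Fin n) → indeg D v ≡ into (allFin N) v
  indeg≡into = arcs-ending proj₂

  walk-balance : (i j : Fin n) (X : List (Fin N)) → isWalk i j X ≡ true → ∀ v → into X v + δ i v ≡ outOf X v + δ j v
  walk-balance i j [] e v rewrite ==⇒≡ e = refl
  walk-balance i j (b ∷ X) e v with ∧≡true⁻ {src b == i} e
  ... | e₁ , e₂ rewrite length-filterᵇ-∷ (λ a → tgt a == v) b X | length-filterᵇ-∷ (λ a → src a == v) b X | ==⇒≡ e₁ =
    begin
      δ (tgt b) v + into X v + δ i v    ≡⟨ cong (_+ δ i v) (+-comm (δ (tgt b) v) (into X v)) ⟩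
      into X v + δ (tgt b) v + δ i v    ≡⟨ cong (_+ δ i v) (walk-balance (tgt b) j X e₂ v) ⟩
      outOf X v + δ j v + δ i v         ≡⟨ solve 3 (λ o d s → o :+ d :+ s := s :+ o :+ d) refl (outOf X v) (δ j v) (δ i v) ⟩
      δ i v + outOf X v + δ j v         ∎
    where open ≡-Reasoning

  walk-enters-end : (u w : Fin n) (W : List (Fin N)) → isWalk u w W ≡ true → ¬ w ≡ u → into W w ≡ suc (outOf W w)
  walk-enters-end u w W walk w≢u = begin
    into W w           ≡⟨ +-identityʳ (into W w) ⟨
    into W w + 0       ≡⟨ cong (into W w +_) (δ-≢ w≢u) ⟨
    into W w + δ u w   ≡⟨ walk-balance u w W walk w ⟩
    outOf W w + δ w w  ≡⟨ cong (outOf W w +_) (δ-self w) ⟩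
    outOf W w + 1      ≡⟨ +-comm (outOf W w) 1 ⟩
    suc (outOf W w)    ∎
    where open ≡-Reasoning

  closedWalk-balanced : (s : Fin n) (X : List (Fin N)) → isWalk s s X ≡ true → ∀ v → into X v ≡ outOf X v
  closedWalk-balanced s X e v = +-cancelʳ-≡ (δ s v) _ _ (walk-balance s s X e v)

  isWalk-++⁻ : (i j : Fin n) (X Y : List (Fin N)) → isWalk i j (X ++ Y) ≡ true →
               Σ (Fin n) λ k → (isWalk i k X ≡ true) × (isWalk k j Y ≡ true)
  isWalk-++⁻ i j [] Y e = i , ==-refl i , e
  isWalk-++⁻ i j (a ∷ X) Y e with ∧≡true⁻ {src a == i} e
  ... | e₁ , e₂ with isWalk-++⁻ (tgt a) j X Y e₂
  ...   | k , w₁ , w₂ = k , ∧≡true⁺ e₁ w₁ , w₂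

  isWalk-++⁺ : (i k j : Fin n) (X Y : List (Fin N)) → isWalk i k X ≡ true → isWalk k j Y ≡ true → isWalk i j (X ++ Y) ≡ true
  isWalk-++⁺ i k j [] Y e₁ e₂ rewrite ==⇒≡ e₁ = e₂
  isWalk-++⁺ i k j (a ∷ X) Y e₁ e₂ with ∧≡true⁻ {src a == i} e₁
  ... | f₁ , f₂ = ∧≡true⁺ f₁ (isWalk-++⁺ (tgt a) k j X Y f₂ e₂)

module Hierholzer {n : ℕ} (d₀ : Var n) (D′ : List (Var n)) where
  open Arcs d₀ D′
  open RootedCircuits d₀ D′
  open Degrees d₀ D′
  open import Data.List.Membership.DecPropositional (Fin._≟_ {N}) using (_∈?_)

  unique-length≤N : (Y : List (Fin N)) → Unique Y → length Y ≤ N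
  unique-length≤N Y u = ≤-trans (Arc.unique⇒length≤ Y (allFin N) u (λ {x} _ → ∈-allFin x)) (≤-reflexive (length-allFin N))

  ExitsUnused : List (Fin N) → Fin n → Set
  ExitsUnused Y w = ∃ λ a → (src a ≡ w) × (a ∉ Y)

  exitsUnused? : (Y : List (Fin N)) (w : Fin n) → Dec (ExitsUnused Y w)
  exitsUnused? Y w = any? (λ a → (src a Fin.≟ w) ×-dec ¬? (a ∈? Y))

  outOf≤ : (w : Fin n) (Y : List (Fin N)) → ¬ ExitsUnused Y w → outOf (allFin N) w ≤ outOf Y w
  outOf≤ w Y none = Arc.unique⇒length≤ _ (filterᵇ (λ a → src a == w) Y) (unique-filterᵇ _ (Unique.allFin⁺ N)) sub
    where
    sub : ∀ {x} → x ∈ filterᵇ (λ a → src a == w) (allFin N) → x ∈ filterᵇ (λ a → src a == w) Y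
    sub {x} m with ∈-filterᵇ⁻ (λ a → src a == w) (allFin N) m
    ... | _ , src≡w with x ∈? Y
    ...   | yes x∈Y = ∈-filterᵇ⁺ _ Y x∈Y src≡w
    ...   | no x∉Y = ⊥-elim (none (x , ==⇒≡ src≡w , x∉Y))

  into≤ : (w : Fin n) (Y : List (Fin N)) → Unique Y → into Y w ≤ into (allFin N) w
  into≤ w Y u = Arc.unique⇒length≤ (filterᵇ enters Y) (filterᵇ enters (allFin N)) (unique-filterᵇ enters u)
                  (λ {x} m → ∈-filterᵇ⁺ enters (allFin N) (∈-allFin x) (proj₂ (∈-filterᵇ⁻ enters Y m)))
    where
    enters : Fin N → Bool
    enters a = tgt a == w

  has-exit : (w : Fin n) (Y : List (Fin N)) → outOf Y w < outOf (allFin N) w → ExitsUnused Y w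
  has-exit w Y fewer with exitsUnused? Y w
  ... | yes exit = exit
  ... | no none = ⊥-elim (<⇒≱ fewer (outOf≤ w Y none))

  LiesOn : List (Fin N) → Fin n → Set
  LiesOn T x = Σ (Fin N) λ t → (t ∈ T) × (src t ≡ x)

  TouchesUnused : List (Fin N) → Fin n → Set
  TouchesUnused T v = Σ (Fin N) λ a → (a ∉ T) × ((src a ≡ v) ⊎ (tgt a ≡ v))

  start-of : (s : Fin n) (T : List (Fin N)) → isWalk s s T ≡ true → ¬ T ≡ [] → LiesOn T s
  start-of s [] _ T≢[] = ⊥-elim (T≢[] refl)
  start-of s (t₀ ∷ _) walk _ = t₀ , here refl , ==⇒≡ (proj₁ (∧≡true⁻ {src t₀ == s} walk))

  module _ {s : Fin n} {T : List (Fin N)} (walk : isWalk s s T ≡ true) where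

    successor : LiesOn T s → ∀ {t} → t ∈ T → LiesOn T (tgt t)
    successor start {t} m with ∈-∃++ m
    successor start {t} m | A , [] , refl with ∧≡true⁻ {isWalk s (src t) A} {tgt t == s} (trans (sym (isWalk-snoc s s A t)) walk)
    ... | _ , e = subst (LiesOn (A ++ [ t ])) (sym (==⇒≡ e)) start
    successor start {t} m | A , b ∷ B , refl with isWalk-++⁻ s s A (t ∷ b ∷ B) walk
    ... | k , _ , w₂ with ∧≡true⁻ {src t == k} w₂
    ...   | _ , w₃ with ∧≡true⁻ {src b == tgt t} w₃
    ...     | e , _ = b , ∈-++⁺ʳ A (there (here refl)) , ==⇒≡ e

    meets-unused : LiesOn T s → ∀ {x v} → LiesOn T x → UReach D x v → TouchesUnused T v →
                   Σ (Fin n) λ y → LiesOn T y × TouchesUnused T y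
    meets-unused start on here touches = _ , on , touches
    meets-unused start {x} on (fwd p r) touches with arc-onto p
    ... | a , refl with a ∈? T
    ...   | no a∉ = x , on , (a , a∉ , inj₁ refl)
    ...   | yes a∈ = meets-unused start (successor start a∈) r touches
    meets-unused start {x} on (bwd p r) touches with arc-onto p
    ... | a , refl with a ∈? T
    ...   | no a∉ = x , on , (a , a∉ , inj₂ refl)
    ...   | yes a∈ = meets-unused start (a , a∈ , refl) r touches

  spanning-closedWalk : (s : Fin n) (T : List (Fin N)) → isWalk s s T ≡ true → Unique T → (∀ e → e ∈ T) → T ∈ rootedCircuits
  spanning-closedWalk s [] walk u all with all zero
  ... | ()
  spanning-closedWalk s (t₀ ∷ T) walk u all = ∈-rootedCircuits⁺ (t₀ ∷ T) perm (isClosedWalk⇒CyclicChain (t₀ ∷ T) closed)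
    where
    once : (xs : List (Fin N)) → Unique xs → (∀ e → e ∈ xs) → ∀ e → Arc.count e xs ≡ 1
    once xs u all e = Arc.unique-∈⇒count≡1 e xs u (all e)
    perm : t₀ ∷ T ↭ allFin N
    perm = Arc.count-≗⇒↭ (t₀ ∷ T) (allFin N) λ e → trans (once (t₀ ∷ T) u all e) (sym (once (allFin N) (Unique.allFin⁺ N) ∈-allFin e))
    closed : isClosedWalk (t₀ ∷ T) ≡ true
    closed with ∧≡true⁻ {src t₀ == s} walk
    ... | e₁ , e₂ rewrite ==⇒≡ e₁ = e₂

  splice : (s y : Fin n) (T W : List (Fin N)) (t : Fin N) → t ∈ T → src t ≡ y →
           isWalk s s T ≡ true → isWalk y y W ≡ true → ¬ W ≡ [] → Unique (T ++ W) →
           Σ (List (Fin N)) λ T′ → (isWalk s s T′ ≡ true) × (¬ T′ ≡ []) × Unique T′ × (length T < length T′)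
  splice s y T W t t∈ src≡y T-walk W-walk W≢[] u with ∈-∃++ t∈
  ... | A , B , refl with isWalk-++⁻ s s A (t ∷ B) T-walk
  ...   | k , w₁ , w₂ with ∧≡true⁻ {src t == k} w₂
  ...     | e₁ , _ = A ++ W ++ t ∷ B , walk′ , nonempty A , unique-↭ perm u , longer
    where
    k≡y : k ≡ y
    k≡y = trans (sym (==⇒≡ e₁)) src≡y
    walk′ : isWalk s s (A ++ W ++ t ∷ B) ≡ true
    walk′ = isWalk-++⁺ s y s A (W ++ t ∷ B) (subst (λ z → isWalk s z A ≡ true) k≡y w₁)
              (isWalk-++⁺ y y s W (t ∷ B) W-walk (subst (λ z → isWalk z s (t ∷ B) ≡ true) k≡y w₂))
    nonempty : (X : List (Fin N)) → ¬ X ++ W ++ t ∷ B ≡ []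
    nonempty [] e = W≢[] (++-conicalˡ W (t ∷ B) e)
    nonempty (_ ∷ _) ()
    perm : (A ++ t ∷ B) ++ W ↭ A ++ W ++ t ∷ B
    perm = ↭-trans (↭-reflexive (++-assoc A (t ∷ B) W)) (++⁺ˡ A (++-comm (t ∷ B) W))
    longer : length (A ++ t ∷ B) < length (A ++ W ++ t ∷ B)
    longer = begin-strict
      length (A ++ t ∷ B)                  <⟨ m<m+n (length (A ++ t ∷ B)) (≢[]⇒length>0 W W≢[]) ⟩
      length (A ++ t ∷ B) + length W       ≡⟨ length-++ (A ++ t ∷ B) ⟨
      length ((A ++ t ∷ B) ++ W)           ≡⟨ ↭-length perm ⟩
      length (A ++ W ++ t ∷ B)             ∎
      where open ≤-Reasoning

  module _ (balanced : ∀ v → indeg D v ≡ outdeg D v) where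

    balanced′ : ∀ v → into (allFin N) v ≡ outOf (allFin N) v
    balanced′ v = trans (sym (indeg≡into v)) (trans (balanced v) (outdeg≡outOf v))

    module _ (T : List (Fin N)) (T-balanced : ∀ v → into T v ≡ outOf T v) where

      -- Greedily extending a walk from u by unused arcs can only get stuck back at u.
      -- The fuel bounds the number of arcs not yet in T ++ W.
      close-walk : (fuel : ℕ) (u w : Fin n) (W : List (Fin N)) → isWalk u w W ≡ true → ¬ W ≡ [] →
                   Unique (T ++ W) → N ≤ fuel + length (T ++ W) →
                   Σ (List (Fin N)) λ W′ → (isWalk u u W′ ≡ true) × (¬ W′ ≡ []) × Unique (T ++ W′)
      close-walk fuel u w W walk W≢[] u′ bound with w Fin.≟ u
      ... | yes refl = W , walk , W≢[] , u′
      ... | no w≢u with has-exit w (T ++ W) surplus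
        where
        surplus : outOf (T ++ W) w < outOf (allFin N) w
        surplus = begin-strict
          outOf (T ++ W) w                ≡⟨ length-filterᵇ-++ _ T W ⟩
          outOf T w + outOf W w           <⟨ +-monoʳ-< (outOf T w) (n<1+n (outOf W w)) ⟩
          outOf T w + suc (outOf W w)     ≡⟨ cong₂ _+_ (T-balanced w) (walk-enters-end u w W walk w≢u) ⟨
          into T w + into W w             ≡⟨ length-filterᵇ-++ _ T W ⟨
          into (T ++ W) w                 ≤⟨ into≤ w (T ++ W) u′ ⟩
          into (allFin N) w               ≡⟨ balanced′ w ⟩
          outOf (allFin N) w              ∎
          where open ≤-Reasoning
      ...   | a , src≡w , a∉ with fuel
      ...     | zero = ⊥-elim (1+n≰n (≤-trans (unique-length≤N _ (unique-∷ a∉ u′)) bound))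
      ...     | suc f = close-walk f u (tgt a) (W ++ [ a ]) walk′ (++-∷ʳ≢[] W a)
                          (subst Unique (++-assoc T W [ a ]) (unique-∷ʳ a∉ u′)) bound′
        where
        walk′ : isWalk u (tgt a) (W ++ [ a ]) ≡ true
        walk′ rewrite isWalk-snoc u (tgt a) W a | src≡w | ==-refl (tgt a) = trans (∧-identityʳ _) walk
        bound′ : N ≤ f + length (T ++ W ++ [ a ])
        bound′ = ≤-trans bound (≤-reflexive (begin
          suc f + length (T ++ W)          ≡⟨ +-suc f (length (T ++ W)) ⟨
          f + suc (length (T ++ W))        ≡⟨ cong (f +_) (+-comm 1 (length (T ++ W))) ⟩
          f + (length (T ++ W) + 1)        ≡⟨ cong (f +_) (length-++ (T ++ W)) ⟨
          f + length ((T ++ W) ++ [ a ])   ≡⟨ cong (λ X → f + length X) (++-assoc T W [ a ]) ⟩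
          f + length (T ++ W ++ [ a ])     ∎))
          where open ≡-Reasoning

    leave-unused : (T : List (Fin N)) → Unique T → (∀ v → into T v ≡ outOf T v) → (y : Fin n) →
                   TouchesUnused T y → ExitsUnused T y
    leave-unused T u T-balanced y (a , a∉ , inj₁ src≡y) = a , src≡y , a∉
    leave-unused T u T-balanced y (a , a∉ , inj₂ tgt≡y) = has-exit y T (begin-strict
      outOf T y             ≡⟨ T-balanced y ⟨
      into T y              <⟨ n<1+n (into T y) ⟩
      suc (into T y)        ≡⟨ entered ⟨
      into (a ∷ T) y        ≤⟨ into≤ y (a ∷ T) (unique-∷ a∉ u) ⟩
      into (allFin N) y     ≡⟨ balanced′ y ⟩
      outOf (allFin N) y    ∎)
      where
      open ≤-Reasoning
      entered : into (a ∷ T) y ≡ suc (into T y)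
      entered rewrite length-filterᵇ-∷ (λ b → tgt b == y) a T | tgt≡y | ==-refl y = refl

    module _ (connected : WeaklyConnected D) where

      extend-to-circuit : (fuel : ℕ) (s : Fin n) (T : List (Fin N)) → isWalk s s T ≡ true → ¬ T ≡ [] → Unique T →
                          N ≤ fuel + length T → ∃ (_∈ rootedCircuits)
      extend-to-circuit fuel s T walk T≢[] u bound with any? (λ e → ¬? (e ∈? T))
      ... | no none = T , spanning-closedWalk s T walk u (λ e → decidable-stable (e ∈? T) (λ e∉ → none (e , e∉)))
      ... | yes (e , e∉) with fuel
      ...   | zero = ⊥-elim (1+n≰n (≤-trans (unique-length≤N (e ∷ T) (unique-∷ e∉ u)) bound))
      ...   | suc f with meets-unused walk start start (connected s (src e) (s-isVertex start) (isVertex-src e)) (e , e∉ , inj₁ refl)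
        where
        start : LiesOn T s
        start = start-of s T walk T≢[]
        s-isVertex : LiesOn T s → IsVertex D s
        s-isVertex (t , _ , src≡s) = subst (IsVertex D) src≡s (isVertex-src t)
      ...     | y , (t , t∈ , src≡y) , touches with leave-unused T u (closedWalk-balanced s T walk) y touches
      ...       | a , src≡y′ , a∉ with close-walk T (closedWalk-balanced s T walk) N y (tgt a) [ a ] first-arc (λ ())
                                                (unique-∷ʳ a∉ u) (m≤m+n N _)
        where
        first-arc : isWalk y (tgt a) [ a ] ≡ true
        first-arc rewrite src≡y′ | ==-refl y | ==-refl (tgt a) = refl
      ...         | W , W-walk , W≢[] , u′ with splice s y T W t t∈ src≡y walk W-walk W≢[] u′
      ...           | T′ , walk′ , T′≢[] , u″ , longer =
        extend-to-circuit f s T′ walk′ T′≢[] u″ (≤-trans bound (≤-trans (≤-reflexive (sym (+-suc f (length T)))) (+-monoʳ-≤ f longer)))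

      rootedCircuit-exists : ∃ (_∈ rootedCircuits)
      rootedCircuit-exists with close-walk [] (λ _ → refl) N (src zero) (tgt zero) [ zero ] first-arc (λ ()) ([] ∷ []) (m≤m+n N 1)
        where
        first-arc : isWalk (src zero) (tgt zero) [ zero ] ≡ true
        first-arc rewrite ==-refl (src zero) | ==-refl (tgt zero) = refl
      ... | W , W-walk , W≢[] , u = extend-to-circuit N (src zero) W W-walk W≢[] u (m≤m+n N _)

module CircuitIsEulerian {n : ℕ} (d₀ : Var n) (D′ : List (Var n)) where
  open Arcs d₀ D′
  open RootedCircuits d₀ D′
  open Degrees d₀ D′

  ureach-trans : ∀ {u w v} → UReach D u w → UReach D w v → UReach D u v
  ureach-trans here q = q
  ureach-trans (fwd p r) q = fwd p (ureach-trans r q)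
  ureach-trans (bwd p r) q = bwd p (ureach-trans r q)

  ureach-sym : ∀ {u v} → UReach D u v → UReach D v u
  ureach-sym here = here
  ureach-sym (fwd p r) = ureach-trans (ureach-sym r) (bwd p here)
  ureach-sym (bwd p r) = ureach-trans (ureach-sym r) (fwd p here)

  walk-reaches : (i j : Fin n) (X : List (Fin N)) → isWalk i j X ≡ true → ∀ {c} → c ∈ X →
                 UReach D i (src c) × UReach D i (tgt c)
  walk-reaches i j (b ∷ X) walk m with ∧≡true⁻ {src b == i} walk
  ... | e₁ , e₂ with ==⇒≡ e₁
  ... | refl with m
  ...   | here refl = here , fwd (∈-lookup b) here
  ...   | there m′ = Product.map (fwd (∈-lookup b)) (fwd (∈-lookup b)) (walk-reaches (tgt b) j X e₂ m′)

  rootedCircuit⇒Eulerian : ∃ (_∈ rootedCircuits) → Eulerian D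
  rootedCircuit⇒Eulerian ([] , σ∈) with () ← closedWalk-of σ∈
  rootedCircuit⇒Eulerian (b ∷ τ , σ∈) = connected , balanced
    where
    σ↭ : b ∷ τ ↭ allFin N
    σ↭ = proj₁ (∈-rootedCircuits⁻ σ∈)
    s : Fin n
    s = src b
    walk : isWalk s s (b ∷ τ) ≡ true
    walk = ∧≡true⁺ (==-refl s) (closedWalk-of σ∈)
    balanced : ∀ v → indeg D v ≡ outdeg D v
    balanced v = begin
      indeg D v                ≡⟨ indeg≡into v ⟩
      into (allFin N) v        ≡⟨ ↭-length (filterᵇ-↭ (λ a → tgt a == v) (↭-sym σ↭)) ⟩
      into (b ∷ τ) v           ≡⟨ closedWalk-balanced s (b ∷ τ) walk v ⟩
      outOf (b ∷ τ) v          ≡⟨ ↭-length (filterᵇ-↭ (λ a → src a == v) σ↭) ⟩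
      outOf (allFin N) v       ≡⟨ outdeg≡outOf v ⟨
      outdeg D v               ∎
      where open ≡-Reasoning
    on-circuit : ∀ a → a ∈ b ∷ τ
    on-circuit a = ∈-resp-↭ (↭-sym σ↭) (∈-allFin a)
    reached : ∀ {u} → IsVertex D u → UReach D s u
    reached (inj₁ any) with find any
    ... | x , m , refl with arc-onto m
    ...   | a , refl = proj₁ (walk-reaches s s (b ∷ τ) walk (on-circuit a))
    reached (inj₂ any) with find any
    ... | x , m , refl with arc-onto m
    ...   | a , refl = proj₂ (walk-reaches s s (b ∷ τ) walk (on-circuit a))
    connected : WeaklyConnected D
    connected u v u∈ v∈ = ureach-trans (ureach-sym (reached u∈)) (reached v∈)

length-operatorOf : ∀ {n k d} (H : KGraph n k) (ds : Fin n → ℕ) (ch : Choice H ds) →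
                    sum (map ds (allFin n)) ≡ d → length (operatorOf H ds ch) ≡ d * (k ∸ 1)
length-operatorOf {n} {k} H ds ch refl = begin
  length (operatorOf H ds ch)                       ≡⟨ length-concatMap row (allFin n) ⟩
  sum (map (length ∘ row) (allFin n))               ≡⟨ cong sum (map-cong length-row (allFin n)) ⟩
  sum (map (λ i → ds i * (k ∸ 1)) (allFin n))       ≡⟨ sum-map-*ʳ ds (k ∸ 1) (allFin n) ⟩
  sum (map ds (allFin n)) * (k ∸ 1)                 ∎
  where
  open ≡-Reasoning
  row : Fin n → List (Var n)
  row i = concatMap (λ t → map (i ,_) (toList (proj₁ t))) (toList (ch i))
  length-row : ∀ i → length (row i) ≡ ds i * (k ∸ 1)
  length-row i = trans (length-concatMap-const (λ t → map (i ,_) (toList (proj₁ t))) (k ∸ 1) {toList (ch i)}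
                         (All.tabulate λ {t} _ → trans (length-map (i ,_) (toList (proj₁ t))) (length-toList (proj₁ t))))
                       (cong (_* (k ∸ 1)) (length-toList (ch i)))

differentiated-trace : ∀ {n} (D : List (Var n)) → 1 ≤ length D →
  ((¬ IsZeroPoly (applyOp D (trPow n (length D)))) ⇔ Eulerian D)
  × (Eulerian D → Σ ℕ (λ c → EulerCount D c × IsConst (applyOp D (trPow n (length D))) (length D * c)))
differentiated-trace (d₀ ∷ D′) _ =
  mk⇔ (λ nonzero → rootedCircuit⇒Eulerian (some-circuit nonzero))
      (λ { (connected , balanced) vanishes → no-circuit vanishes (rootedCircuit-exists balanced connected) }) ,
  λ _ → length circuits₀ , eulerCount , proj₁ applyOp-trPow , trans (proj₂ applyOp-trPow) length-rootedCircuits≡N*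
  where
  open Arcs d₀ D′
  open TraceDerivative d₀ D′
  open RotationClasses d₀ D′
  open Hierholzer d₀ D′
  open CircuitIsEulerian d₀ D′
  some-circuit : ¬ IsZeroPoly (applyOp D (trPow _ N)) → ∃ (_∈ rootedCircuits)
  some-circuit nonzero with rootedCircuits | proj₂ applyOp-trPow
  ... | [] | len≡0 = ⊥-elim (nonzero (length≡0⇒[] len≡0))
    where
    length≡0⇒[] : {X : Set} {xs : List X} → length xs ≡ 0 → xs ≡ []
    length≡0⇒[] {xs = []} _ = refl
  ... | σ ∷ _ | _ = σ , here refl
  no-circuit : IsZeroPoly (applyOp D (trPow _ N)) → ¬ ∃ (_∈ rootedCircuits)
  no-circuit vanishes (σ , σ∈) = ∈⇒length≢0 σ∈ (trans (sym (proj₂ applyOp-trPow)) (cong length vanishes))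
    where
    ∈⇒length≢0 : {X : Set} {x : X} {xs : List X} → x ∈ xs → ¬ length xs ≡ 0
    ∈⇒length≢0 {xs = _ ∷ _} _ ()

lemma1 : ∀ {n k : ℕ} → 2 ≤ k → (H : KGraph n k) → (d : ℕ) → 1 ≤ d
    → (ds : Fin n → ℕ) → sum (map ds (allFin n)) ≡ d
    → (ch : Choice H ds)
    → ((¬ IsZeroPoly (applyOp (operatorOf H ds ch) (trPow n (d * (k ∸ 1)))))
    ⇔ Eulerian (operatorOf H ds ch))
    × (Eulerian (operatorOf H ds ch)
    → Σ ℕ (λ c → EulerCount (operatorOf H ds ch) c
    × IsConst (applyOp (operatorOf H ds ch) (trPow n (d * (k ∸ 1))))
    (length (operatorOf H ds ch) * c)))
lemma1 2≤k H d 1≤d ds sum≡d ch rewrite sym (length-operatorOf H ds ch sum≡d) =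
  differentiated-trace (operatorOf H ds ch) (subst (1 ≤_) (sym (length-operatorOf H ds ch sum≡d)) (positive 1≤d 2≤k))
  where
  positive : ∀ {d k} → 1 ≤ d → 2 ≤ k → 1 ≤ d * (k ∸ 1)
  positive {suc d} {suc (suc k)} _ _ = s≤s z≤n
  positive {suc d} {suc zero} _ (s≤s ())
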